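{- For every integer $N\ge1$, with $\mathbf t_N=(\infty,1,\infty,1,\ldots,\infty,1,\infty,\infty)\in\overline{\mathbb N}_+^{2N}$ (that is, $k_0=\cdots=k_{N-1}=\infty$, $\ell_0=\cdots=\ell_{N-2}=1$, $\ell_{N-1}=\infty$), we have \[ c_{\mathbf t_N}=\frac12+\frac1{4^N}\binom{2N-2}{N-1}-\frac1{12^N}\sum_{0\le j\le N-1}\binom{2N-1}{j}3^j, \] and moreover $c_{\mathbf t_N}>\frac12+\frac1{4\sqrt\pi}N^{ -3/2}$.
   Context: Let $\overline{\mathbb N}_+=\{1,2,3,\ldots\}\cup\{\infty\}$. Let $\alpha,\beta$ be formal variables, $A_0=\begin{pmatrix}1&0\\ \alpha&\beta\end{pmatrix}$, $A_1=\begin{pmatrix}\alpha&\beta\\0&1\end{pmatrix}$ over $\mathbb C[[\alpha,\beta]]$, with usual powers for finite exponents and $A_0^\infty=\begin{pmatrix}1&0\\ \frac{\alpha}{1-\beta}&0\end{pmatrix}$, $A_1^\infty=\begin{pmatrix}0&\frac{\beta}{1-\alpha}\\0&1\end{pmatrix}$. For $\mathbf t=(k_0,\ell_0,\ldots,k_{N-1},\ell_{N-1})\in\overline{\mathbb N}_+^{2N}$, $\gamma_{\mathbf t}(\alpha,\beta)$ is the top-left entry of $A_1^{k_0}A_0^{\ell_0}\cdots A_1^{k_{N-1}}A_0^{\ell_{N-1}}$ and $c_{\mathbf t}=\sum_{i\ge j\ge0}2^{ -(i+j)}[\alpha^i\beta^j]\gamma_{\mathbf t}(\alpha,\beta)$.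 -}

module Defs where

open import Data.Nat as ℕ using (ℕ; zero; suc)
open import Data.Nat.Combinatorics using (_C_)
open import Data.Integer using (+_)
open import Data.Rational using (ℚ; 0ℚ; 1ℚ; ½; _+_; _*_; _-_; _/_; _<_; ∣_∣)
open import Data.List using (List; []; _∷_)
open import Data.Product using (_×_; _,_; Σ; ∃)

ℕ→ℚ : ℕ → ℚ
ℕ→ℚ n = + n / 1

_^ℚ_ : ℚ → ℕ → ℚ
q ^ℚ zero  = 1ℚ
q ^ℚ suc n = q * (q ^ℚ n)

Σ< : ℕ → (ℕ → ℚ) → ℚ
Σ< zero    f = 0ℚ
Σ< (suc n) f = Σ< n f + f n

Σ≤ : ℕ → (ℕ → ℚ) → ℚ
Σ≤ n f = Σ< (suc n) f

-- Formal power series in α, β over ℚ (the relevant coefficients are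
-- rational; ℂ[[α,β]] restricted to these matrices stays in ℚ[[α,β]]).
-- A series is its coefficient function: s i j = [α^i β^j] s.

Series : Set
Series = ℕ → ℕ → ℚ

0s 1s αs βs : Series
0s i j = 0ℚ
1s zero zero = 1ℚ
1s _    _    = 0ℚ
αs (suc zero) zero = 1ℚ
αs _ _ = 0ℚ
βs zero (suc zero) = 1ℚ
βs _ _ = 0ℚ

α/1-β : Series
α/1-β (suc zero) j = 1ℚ
α/1-β _ _ = 0ℚ

β/1-α : Series
β/1-α i (suc zero) = 1ℚ
β/1-α _ _ = 0ℚ

_+s_ : Series → Series → Series
(f +s g) i j = f i j + g i j

_*s_ : Series → Series → Series
(f *s g) i j = Σ≤ i (λ a → Σ≤ j (λ b → f a b * g (i ℕ.∸ a) (j ℕ.∸ b)))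

record Mat : Set where
  constructor mat
  field
    m00 m01 m10 m11 : Series
open Mat public

_⊗_ : Mat → Mat → Mat
mat a b c d ⊗ mat a' b' c' d' =
  mat ((a *s a') +s (b *s c')) ((a *s b') +s (b *s d'))
      ((c *s a') +s (d *s c')) ((c *s b') +s (d *s d'))

I₂ : Mat
I₂ = mat 1s 0s 0s 1s

A₀ A₁ A₀∞ A₁∞ : Mat
A₀  = mat 1s 0s αs βs
A₁  = mat αs βs 0s 1s
A₀∞ = mat 1s 0s α/1-β 0s
A₁∞ = mat 0s β/1-α 0s 1s

-- exponents in ℕ̄₊ = {1,2,3,…} ∪ {∞}; pos n stands for n+1
data ℕ̄₊ : Set where
  pos : ℕ → ℕ̄₊
  ∞   : ℕ̄₊

_^M_ : Mat → ℕ → Mat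
M ^M zero  = I₂
M ^M suc n = M ⊗ (M ^M n)

A₀^ A₁^ : ℕ̄₊ → Mat
A₀^ (pos n) = A₀ ^M suc n
A₀^ ∞       = A₀∞
A₁^ (pos n) = A₁ ^M suc n
A₁^ ∞       = A₁∞

-- t = (k₀,ℓ₀,…,k_{N-1},ℓ_{N-1}) as the list of pairs (k_i, ℓ_i)
prodT : List (ℕ̄₊ × ℕ̄₊) → Mat
prodT []            = I₂
prodT ((k , l) ∷ t) = (A₁^ k ⊗ A₀^ l) ⊗ prodT t

γ : List (ℕ̄₊ × ℕ̄₊) → Series
γ t = m00 (prodT t)

cPartial : List (ℕ̄₊ × ℕ̄₊) → ℕ → ℚ
cPartial t m = Σ< m (λ i → Σ≤ i (λ j → (½ ^ℚ (i ℕ.+ j)) * γ t i j))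

CEquals : List (ℕ̄₊ × ℕ̄₊) → ℚ → Set
CEquals t v = ∀ (ε : ℚ) → 0ℚ < ε →
  ∃ λ M → ∀ m → M ℕ.≤ m → ∣ cPartial t m - v ∣ < ε

tN : ℕ → List (ℕ̄₊ × ℕ̄₊)
tN zero          = []
tN (suc zero)    = (∞ , ∞) ∷ []
tN (suc (suc n)) = (∞ , pos 0) ∷ tN (suc n)

closedForm : ℕ → ℚ
closedForm N =
  ½ + ℕ→ℚ (((2 ℕ.* N) ℕ.∸ 2) C (N ℕ.∸ 1)) * ((+ 1 / 4) ^ℚ N)
    - ((+ 1 / 12) ^ℚ N) * Σ< N (λ j → ℕ→ℚ (((2 ℕ.* N ℕ.∸ 1) C j) ℕ.* (3 ℕ.^ j)))

-- π via the Leibniz series grouped in pairs: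
-- π = Σ_{k≥0} (4/(4k+1) - 4/(4k+3)) = Σ_{k≥0} 8/((4k+1)(4k+3)).
-- The partial sums πLower n are strictly increasing with limit π, so for
-- q ∈ ℚ,  π > q  ⟺  ∃ n, πLower n > q.
πLower : ℕ → ℚ
πLower n = Σ< n (λ k → + 8 / (suc (4 ℕ.* k) ℕ.* suc (suc (suc (4 ℕ.* k)))))

-- "x > 1/2 + (1/(4√π)) N^{-3/2}" for rational x and N ≥ 1.
-- With d = x - 1/2 this holds iff d > 0 and 16 π N³ d² > 1, i.e.
-- d > 0 and π > q for q = 1/(16 N³ d²), i.e. d > 0 and ∃ n, 16 N³ d² πLower n > 1.
AboveBound : ℕ → ℚ → Set
AboveBound N x =
  (0ℚ < x - ½) ×
  ∃ λ n → 1ℚ < ℕ→ℚ (16 ℕ.* (N ℕ.^ 3)) * ((x - ½) * (x - ½)) * πLower n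

module Submission where

-- Since A₀^∞ has a zero right column, so has the product for t_N (N = n + 1).  Left multiplication by
-- A₁^∞ A₀ acts on its left column through the Pascal rule, and induction on n shows that this column is
-- (α (1 - α)⁻ᴺ βᴺ, α (1 - α)⁻⁽ᴺ⁻¹⁾ βᴺ⁻¹) / (1 - β); in particular γ_{t_N} = α (1 - α)⁻ᴺ βᴺ / (1 - β).
-- Summing the geometric β-part, row i + 1 of c_t contributes C(i + n, n) 2⁻⁽ⁱ⁺¹⁾ (2⁻ⁿ - 2⁻⁽ⁱ⁺¹⁾) for
-- i ≥ n and nothing before, so the partial sums of c_t are differences of truncations of (1 - z)⁻ᴺ at
-- z = ½ and z = ¼.  The negative binomial duality
--   (1 - z)ᴺ Σ_{k<m} C(k + n, n) zᵏ + zᵐ Σ_{s≤n} C(m + s - 1, s) (1 - z)ˢ = 1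
-- evaluates them exactly: the error term is O(C(m + n, n) 2⁻ᵐ), which decays geometrically, and the
-- truncations at m = n satisfy a recursion in n that produces the closed formula.
-- For the lower bound, c_t - ½ = δ / 12ᴺ with δ = 3ᴺ C(2n, n) - Σ_{j≤n} C(2n + 1, j) 3ʲ.  The terms of
-- this sum grow at least by the factor 3(n + 2)/n, so δ ≥ (3n + 4) 3ᴺ C(2n, n) / ((2n + 6) N), and with
-- 16ⁿ ≤ (4n + 1) C(2n, n)² and π > 304/105 this gives 16 N³ (c_t - ½)² π > 1.

open import Defs

module Binomial where
  open import Data.Nat
  open import Data.Nat.Properties
  open import Data.Nat.Combinatorics using (_C_; nCk+nC[k+1]≡[n+1]C[k+1]; nCk≡nC[n∸k]; k>n⇒nCk≡0; nC1≡n)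
  open import Data.Nat.Tactic.RingSolver using (solve-∀)
  open import Relation.Binary.PropositionalEquality

  pascal : ∀ n k → suc n C suc k ≡ n C k + n C suc k
  pascal n k = sym (nCk+nC[k+1]≡[n+1]C[k+1] n k)

  0<[k+n]Cn : ∀ k n → 0 < (k + n) C n
  0<[k+n]Cn k zero    = s≤s z≤n
  0<[k+n]Cn k (suc n) = begin-strict
    0                                  <⟨ 0<[k+n]Cn k n ⟩
    (k + n) C n                        ≤⟨ m≤m+n _ _ ⟩
    (k + n) C n + (k + n) C suc n      ≡⟨ sym (pascal (k + n) n) ⟩
    suc (k + n) C suc n                ≡⟨ cong (_C suc n) (sym (+-suc k n)) ⟩
    (k + suc n) C suc n                ∎
    where open ≤-Reasoning

  absorption : ∀ n k → suc k * (suc n C suc k) ≡ suc n * (n C k)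
  absorption zero    zero    = refl
  absorption zero    (suc k) rewrite k>n⇒nCk≡0 {1} {suc (suc k)} (s≤s (s≤s z≤n))
                                   | k>n⇒nCk≡0 {0} {suc k} (s≤s z≤n) = *-zeroʳ (suc (suc k))
  absorption (suc n) zero    rewrite nC1≡n (suc (suc n)) = cong (λ z → suc (suc z)) (trans (+-identityʳ n) (sym (*-identityʳ n)))
  absorption (suc n) (suc k) = begin
    suc (suc k) * (suc (suc n) C suc (suc k))
      ≡⟨ cong (suc (suc k) *_) (pascal (suc n) (suc k)) ⟩
    suc (suc k) * (suc n C suc k + suc n C suc (suc k))
      ≡⟨ *-distribˡ-+ (suc (suc k)) (suc n C suc k) _ ⟩
    suc (suc k) * (suc n C suc k) + suc (suc k) * (suc n C suc (suc k))
      ≡⟨ cong₂ (λ a b → a + b) (cong (suc n C suc k +_) (absorption n k)) (absorption n (suc k)) ⟩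
    suc n C suc k + suc n * (n C k) + suc n * (n C suc k)
      ≡⟨ regroup (suc n C suc k) (n C k) (n C suc k) (suc n) ⟩
    suc n C suc k + suc n * (n C k + n C suc k)
      ≡⟨ cong (λ z → suc n C suc k + suc n * z) (sym (pascal n k)) ⟩
    suc n C suc k + suc n * (suc n C suc k)
      ∎
    where
    open ≡-Reasoning
    regroup : ∀ a b c m → a + m * b + m * c ≡ a + m * (b + c)
    regroup = solve-∀

  consecutive-ratio : ∀ n k → suc k * (n C suc k) + suc k * (n C k) ≡ suc n * (n C k)
  consecutive-ratio n k = begin
    suc k * (n C suc k) + suc k * (n C k)   ≡⟨ +-comm (suc k * (n C suc k)) _ ⟩
    suc k * (n C k) + suc k * (n C suc k)   ≡⟨ sym (*-distribˡ-+ (suc k) (n C k) _) ⟩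
    suc k * (n C k + n C suc k)             ≡⟨ cong (suc k *_) (sym (pascal n k)) ⟩
    suc k * (suc n C suc k)                 ≡⟨ absorption n k ⟩
    suc n * (n C k)                         ∎
    where open ≡-Reasoning

  middle-symmetry : ∀ n → suc (n + n) C n ≡ suc (n + n) C suc n
  middle-symmetry n = trans (nCk≡nC[n∸k] (m≤n+m n (suc n))) (cong (suc (n + n) C_) (m+n∸n≡m (suc n) n))

  central-doubling : ∀ n → (suc n + suc n) C suc n ≡ 2 * (suc (n + n) C suc n)
  central-doubling n = begin
    (suc n + suc n) C suc n                      ≡⟨ pascal (n + suc n) n ⟩
    (n + suc n) C n + (n + suc n) C suc n        ≡⟨ cong (λ m → m C n + m C suc n) (+-suc n n) ⟩
    suc (n + n) C n + suc (n + n) C suc n        ≡⟨ cong (_+ suc (n + n) C suc n) (middle-symmetry n) ⟩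
    suc (n + n) C suc n + suc (n + n) C suc n    ≡⟨ cong (suc (n + n) C suc n +_) (sym (+-identityʳ (suc (n + n) C suc n))) ⟩
    2 * (suc (n + n) C suc n)                    ∎
    where open ≡-Reasoning

  central-recurrence : ∀ n → suc n * ((suc n + suc n) C suc n) ≡ 2 * (suc (n + n) * ((n + n) C n))
  central-recurrence n = begin
    suc n * ((suc n + suc n) C suc n)        ≡⟨ cong (suc n *_) (central-doubling n) ⟩
    suc n * (2 * (suc (n + n) C suc n))      ≡⟨ x*[2*y]≡2*[x*y] (suc n) (suc (n + n) C suc n) ⟩
    2 * (suc n * (suc (n + n) C suc n))      ≡⟨ cong (2 *_) (absorption (n + n) n) ⟩
    2 * (suc (n + n) * ((n + n) C n))        ∎
    where
    open ≡-Reasoning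
    x*[2*y]≡2*[x*y] : ∀ x y → x * (2 * y) ≡ 2 * (x * y)
    x*[2*y]≡2*[x*y] = solve-∀

  Σℕ< : ℕ → (ℕ → ℕ) → ℕ
  Σℕ< zero    f = 0
  Σℕ< (suc n) f = Σℕ< n f + f n

  -- C(m + s - 1, s) = [xˢ] (1 - x)⁻ᵐ, written so that m = 0 needs no truncated subtraction
  negBinomCoeff : ℕ → ℕ → ℕ
  negBinomCoeff m zero    = 1
  negBinomCoeff m (suc s) = (m + s) C suc s

  Σ-negBinomCoeff : ∀ m n → Σℕ< (suc n) (negBinomCoeff m) ≡ (m + n) C n
  Σ-negBinomCoeff m zero    = refl
  Σ-negBinomCoeff m (suc n) = begin
    Σℕ< (suc n) (negBinomCoeff m) + (m + n) C suc n   ≡⟨ cong (_+ (m + n) C suc n) (Σ-negBinomCoeff m n) ⟩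
    (m + n) C n + (m + n) C suc n                 ≡⟨ sym (pascal (m + n) n) ⟩
    suc (m + n) C suc n                           ≡⟨ cong (_C suc n) (sym (+-suc m n)) ⟩
    (m + suc n) C suc n                           ∎
    where open ≡-Reasoning

  rowSum₃ : ℕ → ℕ → ℕ
  rowSum₃ M K = Σℕ< K (λ j → (M C j) * 3 ^ j)

  rowSum₃-pascal : ∀ M K → rowSum₃ (suc M) (suc K) ≡ rowSum₃ M (suc K) + 3 * rowSum₃ M K
  rowSum₃-pascal M zero    = refl
  rowSum₃-pascal M (suc K) = begin
    rowSum₃ (suc M) (suc K) + (suc M C suc K) * 3 ^ suc K
      ≡⟨ cong₂ (λ a b → a + b * 3 ^ suc K) (rowSum₃-pascal M K) (pascal M K) ⟩
    (rowSum₃ M (suc K) + 3 * rowSum₃ M K) + ((M C K) + (M C suc K)) * (3 * 3 ^ K)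
      ≡⟨ regroup (rowSum₃ M (suc K)) (rowSum₃ M K) (M C K) (M C suc K) (3 ^ K) ⟩
    (rowSum₃ M (suc K) + (M C suc K) * (3 * 3 ^ K)) + 3 * (rowSum₃ M K + (M C K) * 3 ^ K)
      ∎
    where
    open ≡-Reasoning
    regroup : ∀ a b c d t → (a + 3 * b) + (c + d) * (3 * t) ≡ (a + d * (3 * t)) + 3 * (b + c * t)
    regroup = solve-∀

  oddRowSum₃ : ℕ → ℕ
  oddRowSum₃ n = rowSum₃ (suc (n + n)) (suc n)

  oddRowSum₃-rec : ∀ n → oddRowSum₃ (suc n) + 6 * (3 ^ n * (suc (n + n) C suc n)) ≡ 16 * oddRowSum₃ n
  oddRowSum₃-rec n = begin
    rowSum₃ (suc (suc n + suc n)) (suc (suc n)) + 6 * (t * d)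
      ≡⟨ cong (λ x → rowSum₃ (suc (suc x)) (suc (suc n)) + 6 * (t * d)) (+-suc n n) ⟩
    rowSum₃ (suc (suc M)) (suc (suc n)) + 6 * (t * d)
      ≡⟨ cong (_+ 6 * (t * d)) (rowSum₃-pascal (suc M) (suc n)) ⟩
    (rowSum₃ (suc M) (suc (suc n)) + 3 * rowSum₃ (suc M) (suc n)) + 6 * (t * d)
      ≡⟨ cong₂ (λ a b → (a + 3 * b) + 6 * (t * d)) (rowSum₃-pascal M (suc n)) (rowSum₃-pascal M n) ⟩
    ((rowSum₃ M (suc (suc n)) + 3 * rowSum₃ M (suc n)) + 3 * (rowSum₃ M (suc n) + 3 * rowSum₃ M n)) + 6 * (t * d)
      ≡⟨ cong (λ x → ((s + x * t + d * (3 * t)) + 3 * (s + x * t)) + 3 * ((s + x * t) + 3 * s) + 6 * (t * d))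
              (middle-symmetry n) ⟩
    ((s + d * t + d * (3 * t)) + 3 * (s + d * t)) + 3 * ((s + d * t) + 3 * s) + 6 * (t * d)
      ≡⟨ collect s d t ⟩
    16 * (s + d * t)
      ≡⟨ cong (λ x → 16 * (s + x * t)) (sym (middle-symmetry n)) ⟩
    16 * oddRowSum₃ n
      ∎
    where
    open ≡-Reasoning
    M = suc (n + n)
    t = 3 ^ n
    d = M C suc n
    s = rowSum₃ M n
    collect : ∀ s d t → ((s + d * t + d * (3 * t)) + 3 * (s + d * t)) + 3 * ((s + d * t) + 3 * s) + 6 * (t * d)
                        ≡ 16 * (s + d * t)
    collect = solve-∀

module BinomialEstimates where
  open import Data.Nat
  open import Data.Nat.Properties
  open import Data.Product using (_,_)
  open import Data.Unit using (tt)
  open import Data.Nat.Combinatorics using (_C_)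
  open import Data.Nat.Tactic.RingSolver using (solve-∀)
  open import Relation.Binary.PropositionalEquality
  open Binomial

  2[M+1Cn]≤3[MCn] : ∀ n M → n + n + n ≤ M → 2 * (suc M C n) ≤ 3 * (M C n)
  2[M+1Cn]≤3[MCn] zero    M _  = s≤s (s≤s z≤n)
  2[M+1Cn]≤3[MCn] (suc k) M 3n≤M = begin
    2 * (suc M C suc k)     ≡⟨ cong (2 *_) (pascal M k) ⟩
    2 * (a + b)             ≡⟨ *-distribˡ-+ 2 a b ⟩
    2 * a + 2 * b           ≤⟨ +-monoˡ-≤ (2 * b) 2a≤b ⟩
    b + 2 * b               ≡⟨ b+2b≡3b b ⟩
    3 * b                   ∎
    where
    open ≤-Reasoning
    a = M C k
    b = M C suc k
    b+2b≡3b : ∀ b → b + 2 * b ≡ 3 * b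
    b+2b≡3b = solve-∀
    3[k+1]≤M+1 : 3 * suc k ≤ suc M
    3[k+1]≤M+1 = ≤-trans (≤-reflexive (3[k+1]≡ k)) (m≤n⇒m≤1+n 3n≤M)
      where
      3[k+1]≡ : ∀ k → 3 * suc k ≡ suc k + suc k + suc k
      3[k+1]≡ = solve-∀
    -- (k + 1) C(M, k + 1) = (M - k) C(M, k) and M - k ≥ 2 (k + 1)
    2a≤b : 2 * a ≤ b
    2a≤b = *-cancelˡ-≤ (suc k) (+-cancelʳ-≤ (suc k * a) _ _ (begin
      suc k * (2 * a) + suc k * a   ≡⟨ regroup k a ⟩
      (3 * suc k) * a               ≤⟨ *-monoˡ-≤ a 3[k+1]≤M+1 ⟩
      suc M * a                     ≡⟨ sym (consecutive-ratio M k) ⟩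
      suc k * b + suc k * a         ∎))
      where
      regroup : ∀ k a → suc k * (2 * a) + suc k * a ≡ (3 * suc k) * a
      regroup = solve-∀

  2^t[t+MCn]≤3^t[MCn] : ∀ n M t → n + n + n ≤ M → 2 ^ t * ((t + M) C n) ≤ 3 ^ t * (M C n)
  2^t[t+MCn]≤3^t[MCn] n M zero    _    = ≤-refl
  2^t[t+MCn]≤3^t[MCn] n M (suc t) 3n≤M = begin
    2 * 2 ^ t * (suc (t + M) C n)        ≡⟨ regroup (2 ^ t) (suc (t + M) C n) ⟩
    2 ^ t * (2 * (suc (t + M) C n))      ≤⟨ *-monoʳ-≤ (2 ^ t) (2[M+1Cn]≤3[MCn] n (t + M) (≤-trans 3n≤M (m≤n+m M t))) ⟩
    2 ^ t * (3 * ((t + M) C n))          ≡⟨ regroup′ (2 ^ t) ((t + M) C n) ⟩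
    3 * (2 ^ t * ((t + M) C n))          ≤⟨ *-monoʳ-≤ 3 (2^t[t+MCn]≤3^t[MCn] n M t 3n≤M) ⟩
    3 * (3 ^ t * (M C n))                ≡⟨ sym (*-assoc 3 (3 ^ t) (M C n)) ⟩
    3 * 3 ^ t * (M C n)                  ∎
    where
    open ≤-Reasoning
    regroup : ∀ p c → 2 * p * c ≡ p * (2 * c)
    regroup = solve-∀
    regroup′ : ∀ p c → p * (3 * c) ≡ 3 * (p * c)
    regroup′ = solve-∀

  3^t[3+t]≤3*4^t : ∀ t → 3 ^ t * (3 + t) ≤ 3 * 4 ^ t
  3^t[3+t]≤3*4^t zero    = ≤-refl
  3^t[3+t]≤3*4^t (suc t) = begin
    3 * 3 ^ t * (3 + suc t)      ≡⟨ expand (3 ^ t) t ⟩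
    3 ^ t * (12 + 3 * t)         ≤⟨ *-monoʳ-≤ (3 ^ t) (+-monoʳ-≤ 12 (*-monoˡ-≤ t (s≤s (s≤s (s≤s (z≤n {1})))))) ⟩
    3 ^ t * (12 + 4 * t)         ≡⟨ factor (3 ^ t) t ⟩
    4 * (3 ^ t * (3 + t))        ≤⟨ *-monoʳ-≤ 4 (3^t[3+t]≤3*4^t t) ⟩
    4 * (3 * 4 ^ t)              ≡⟨ 4[3q]≡3[4q] (4 ^ t) ⟩
    3 * (4 * 4 ^ t)              ∎
    where
    open ≤-Reasoning
    expand : ∀ p t → 3 * p * (3 + suc t) ≡ p * (12 + 3 * t)
    expand = solve-∀
    factor : ∀ p t → p * (12 + 4 * t) ≡ 4 * (p * (3 + t))
    factor = solve-∀
    4[3q]≡3[4q] : ∀ q → 4 * (3 * q) ≡ 3 * (4 * q)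
    4[3q]≡3[4q] = solve-∀

  3^[3X]*X<4^[3X] : ∀ X → 3 ^ (3 * X) * X < 4 ^ (3 * X)
  3^[3X]*X<4^[3X] X = begin-strict
    p * X          <⟨ m<m+n (p * X) (m^n>0 3 (3 * X)) ⟩
    p * X + p      ≡⟨ factor p X ⟩
    p * (1 + X)    ≤⟨ *-cancelˡ-≤ 3 (≤-trans (≤-reflexive (factor′ p X)) (3^t[3+t]≤3*4^t (3 * X))) ⟩
    4 ^ (3 * X)    ∎
    where
    open ≤-Reasoning
    p = 3 ^ (3 * X)
    factor : ∀ p X → p * X + p ≡ p * (1 + X)
    factor = solve-∀
    factor′ : ∀ p X → 3 * (p * (1 + X)) ≡ p * (3 + 3 * X)
    factor′ = solve-∀

  oddRow-ratio : ∀ n i → suc i ≤ n → (n + 2) * (suc (n + n) C i) ≤ n * (suc (n + n) C suc i)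
  oddRow-ratio n i i<n = *-cancelˡ-≤ (suc i) (+-cancelʳ-≤ (n * (suc i * a)) _ _ (begin
    suc i * ((n + 2) * a) + n * (suc i * a)   ≡⟨ expand n i a ⟩
    (suc i * (2 + (n + n))) * a               ≤⟨ *-monoˡ-≤ a (*-monoˡ-≤ (2 + (n + n)) i<n) ⟩
    (n * (2 + (n + n))) * a                   ≡⟨ regroup n a ⟩
    n * (suc M * a)                           ≡⟨ cong (n *_) (sym (consecutive-ratio M i)) ⟩
    n * (suc i * b + suc i * a)               ≡⟨ distribute n i b a ⟩
    suc i * (n * b) + n * (suc i * a)         ∎))
    where
    open ≤-Reasoning
    M = suc (n + n)
    a = M C i
    b = M C suc i
    expand : ∀ n i a → suc i * ((n + 2) * a) + n * (suc i * a) ≡ (suc i * (2 + (n + n))) * a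
    expand = solve-∀
    regroup : ∀ n a → (n * (2 + (n + n))) * a ≡ n * (suc (suc (n + n)) * a)
    regroup = solve-∀
    distribute : ∀ n i b a → n * (suc i * b + suc i * a) ≡ suc i * (n * b) + n * (suc i * a)
    distribute = solve-∀

  oddRowTerm : ℕ → ℕ → ℕ
  oddRowTerm n i = (suc (n + n) C i) * 3 ^ i

  -- The terms grow at least by the factor 3(n + 2)/n, so the sum is dominated by a geometric series.
  rowSum₃-tail : ∀ n i → i ≤ n → (2 * n + 6) * rowSum₃ (suc (n + n)) (suc i) ≤ 3 * (n + 2) * oddRowTerm n i
  rowSum₃-tail n zero    _   = begin
    (2 * n + 6) * (0 + 1 * 1)  ≡⟨ simplify n ⟩
    2 * n + 6                  ≤⟨ +-monoˡ-≤ 6 (*-monoˡ-≤ n (s≤s (s≤s (z≤n {1})))) ⟩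
    3 * n + 6                  ≡⟨ factor n ⟩
    3 * (n + 2) * (1 * 1)      ∎
    where
    open ≤-Reasoning
    simplify : ∀ n → (2 * n + 6) * (0 + 1 * 1) ≡ 2 * n + 6
    simplify = solve-∀
    factor : ∀ n → 3 * n + 6 ≡ 3 * (n + 2) * (1 * 1)
    factor = solve-∀
  rowSum₃-tail n (suc i) i<n = begin
    G * (rowSum₃ M (suc i) + oddRowTerm n (suc i))      ≡⟨ *-distribˡ-+ G (rowSum₃ M (suc i)) _ ⟩
    G * rowSum₃ M (suc i) + G * oddRowTerm n (suc i)    ≤⟨ +-monoˡ-≤ _ (rowSum₃-tail n i (≤-trans (n≤1+n i) i<n)) ⟩
    3 * (n + 2) * oddRowTerm n i + G * oddRowTerm n (suc i)
      ≡⟨ cong (_+ G * oddRowTerm n (suc i)) (regroup n (M C i) (3 ^ i)) ⟩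
    3 ^ i * (3 * ((n + 2) * (M C i))) + G * oddRowTerm n (suc i)
      ≤⟨ +-monoˡ-≤ _ (*-monoʳ-≤ (3 ^ i) (*-monoʳ-≤ 3 (oddRow-ratio n i i<n))) ⟩
    3 ^ i * (3 * (n * (M C suc i))) + G * oddRowTerm n (suc i)
      ≡⟨ collect n (M C suc i) (3 ^ i) ⟩
    3 * (n + 2) * oddRowTerm n (suc i)                  ∎
    where
    open ≤-Reasoning
    M = suc (n + n)
    G = 2 * n + 6
    regroup : ∀ n c p → 3 * (n + 2) * (c * p) ≡ p * (3 * ((n + 2) * c))
    regroup = solve-∀
    collect : ∀ n d p → p * (3 * (n * d)) + (2 * n + 6) * (d * (3 * p)) ≡ 3 * (n + 2) * (d * (3 * p))
    collect = solve-∀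

  centralTerm₃ : ℕ → ℕ
  centralTerm₃ n = 3 ^ suc n * ((n + n) C n)

  oddRowSum₃-bound : ∀ n → (2 * n + 6) * suc n * oddRowSum₃ n ≤ (n + 2) * (2 * n + 1) * centralTerm₃ n
  oddRowSum₃-bound n = begin
    (2 * n + 6) * suc n * oddRowSum₃ n                         ≡⟨ regroup n (oddRowSum₃ n) ⟩
    suc n * ((2 * n + 6) * oddRowSum₃ n)                       ≤⟨ *-monoʳ-≤ (suc n) (rowSum₃-tail n n ≤-refl) ⟩
    suc n * (3 * (n + 2) * ((M C n) * 3 ^ n))                  ≡⟨ regroup′ n (M C n) (3 ^ n) ⟩
    3 * (n + 2) * 3 ^ n * (suc n * (M C n))                    ≡⟨ cong (λ x → 3 * (n + 2) * 3 ^ n * (suc n * x)) (middle-symmetry n) ⟩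
    3 * (n + 2) * 3 ^ n * (suc n * (M C suc n))                ≡⟨ cong (3 * (n + 2) * 3 ^ n *_) (absorption (n + n) n) ⟩
    3 * (n + 2) * 3 ^ n * (M * ((n + n) C n))                  ≡⟨ regroup″ n (3 ^ n) ((n + n) C n) ⟩
    (n + 2) * (2 * n + 1) * centralTerm₃ n                     ∎
    where
    open ≤-Reasoning
    M = suc (n + n)
    regroup : ∀ n q → (2 * n + 6) * suc n * q ≡ suc n * ((2 * n + 6) * q)
    regroup = solve-∀
    regroup′ : ∀ n c p → suc n * (3 * (n + 2) * (c * p)) ≡ 3 * (n + 2) * p * (suc n * c)
    regroup′ = solve-∀
    regroup″ : ∀ n p c → 3 * (n + 2) * p * (suc (n + n) * c) ≡ (n + 2) * (2 * n + 1) * (3 * p * c)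
    regroup″ = solve-∀

  central-lower-bound : ∀ n → 16 ^ n ≤ ((n + n) C n) * ((n + n) C n) * suc (4 * n)
  central-lower-bound zero    = ≤-refl
  central-lower-bound (suc n) = *-cancelʳ-≤ (16 * 16 ^ n) (c′ * c′ * suc (4 * suc n)) Z (begin
    16 * 16 ^ n * Z                        ≤⟨ m≤m+n (16 * 16 ^ n * Z) (4 * 16 ^ n) ⟩
    16 * 16 ^ n * Z + 4 * 16 ^ n           ≡⟨ expand n (16 ^ n) ⟩
    16 ^ n * R                             ≤⟨ *-monoˡ-≤ R (central-lower-bound n) ⟩
    c * c * suc (4 * n) * R                ≡⟨ regroup n c ⟩
    (2 * (suc (n + n) * c)) * (2 * (suc (n + n) * c)) * suc (4 * suc n) * suc (4 * n)
      ≡⟨ cong (λ y → y * y * suc (4 * suc n) * suc (4 * n)) (sym (central-recurrence n)) ⟩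
    (suc n * c′) * (suc n * c′) * suc (4 * suc n) * suc (4 * n)
      ≡⟨ regroup′ n c′ ⟩
    c′ * c′ * suc (4 * suc n) * Z          ∎)
    where
    open ≤-Reasoning
    c = (n + n) C n
    c′ = (suc n + suc n) C suc n
    Z = suc n * suc n * suc (4 * n)
    R = 4 * (suc (n + n) * suc (n + n)) * suc (4 * suc n)
    expand : ∀ n p → 16 * p * (suc n * suc n * suc (4 * n)) + 4 * p
                     ≡ p * (4 * (suc (n + n) * suc (n + n)) * suc (4 * suc n))
    expand = solve-∀
    regroup : ∀ n c → c * c * suc (4 * n) * (4 * (suc (n + n) * suc (n + n)) * suc (4 * suc n))
                      ≡ (2 * (suc (n + n) * c)) * (2 * (suc (n + n) * c)) * suc (4 * suc n) * suc (4 * n)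
    regroup = solve-∀
    regroup′ : ∀ n d → (suc n * d) * (suc n * d) * suc (4 * suc n) * suc (4 * n)
                       ≡ d * d * suc (4 * suc n) * (suc n * suc n * suc (4 * n))
    regroup′ = solve-∀

  centralExcess : ℕ → ℕ
  centralExcess n = centralTerm₃ n ∸ oddRowSum₃ n

  [2n+6][n+1]≡[n+2][2n+1]+[3n+4] : ∀ n → (2 * n + 6) * suc n ≡ (n + 2) * (2 * n + 1) + (3 * n + 4)
  [2n+6][n+1]≡[n+2][2n+1]+[3n+4] = solve-∀

  oddRowSum₃≤centralTerm₃ : ∀ n → oddRowSum₃ n ≤ centralTerm₃ n
  oddRowSum₃≤centralTerm₃ n = *-cancelˡ-≤ ((2 * n + 6) * suc n) (≤-trans (oddRowSum₃-bound n)
    (*-monoˡ-≤ (centralTerm₃ n) (≤-trans (m≤m+n ((n + 2) * (2 * n + 1)) (3 * n + 4)) (≤-reflexive (sym ([2n+6][n+1]≡[n+2][2n+1]+[3n+4] n))))))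
    where
    instance
      [2n+6][n+1]≢0 : NonZero ((2 * n + 6) * suc n)
      [2n+6][n+1]≢0 = m*n≢0 (2 * n + 6) (suc n) {{>-nonZero (≤-trans (s≤s z≤n) (m≤n+m 6 (2 * n)))}}

  centralExcess-bound : ∀ n → (3 * n + 4) * centralTerm₃ n ≤ (2 * n + 6) * suc n * centralExcess n
  centralExcess-bound n = +-cancelʳ-≤ (B * P) _ _ (begin
    (3 * n + 4) * P + B * P         ≡⟨ sym (*-distribʳ-+ P (3 * n + 4) B) ⟩
    ((3 * n + 4) + B) * P           ≡⟨ cong (_* P) (trans (+-comm (3 * n + 4) B) (sym ([2n+6][n+1]≡[n+2][2n+1]+[3n+4] n))) ⟩
    A * P                           ≡⟨ cong (A *_) (sym (m∸n+n≡m (oddRowSum₃≤centralTerm₃ n))) ⟩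
    A * (centralExcess n + Q)       ≡⟨ *-distribˡ-+ A (centralExcess n) Q ⟩
    A * centralExcess n + A * Q     ≤⟨ +-monoʳ-≤ (A * centralExcess n) (oddRowSum₃-bound n) ⟩
    A * centralExcess n + B * P     ∎)
    where
    open ≤-Reasoning
    P = centralTerm₃ n
    Q = oddRowSum₃ n
    A = (2 * n + 6) * suc n
    B = (n + 2) * (2 * n + 1)

  ^-distribʳ-* : ∀ a b k → (a * b) ^ k ≡ a ^ k * b ^ k
  ^-distribʳ-* a b zero    = refl
  ^-distribʳ-* a b (suc k) = trans (cong (a * b *_) (^-distribʳ-* a b k)) (interchange a b (a ^ k) (b ^ k))
    where
    interchange : ∀ a b x y → a * b * (x * y) ≡ a * x * (b * y)
    interchange = solve-∀

  quadratic-inequality : ∀ n → 5 ≤ n → 105 * ((n + 3) * (n + 3)) ≤ 19 * ((3 * n + 4) * (3 * n + 4))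
  quadratic-inequality n 5≤n with m≤n⇒∃[o]m+o≡n 5≤n
  ... | y , refl = begin
    105 * ((5 + y + 3) * (5 + y + 3))                                        ≤⟨ m≤m+n _ _ ⟩
    105 * ((5 + y + 3) * (5 + y + 3)) + (66 * (y * y) + 486 * y + 139)       ≡⟨ expand y ⟩
    19 * ((3 * (5 + y) + 4) * (3 * (5 + y) + 4))                             ∎
    where
    open ≤-Reasoning
    expand : ∀ y → 105 * ((5 + y + 3) * (5 + y + 3)) + (66 * (y * y) + 486 * y + 139)
                   ≡ 19 * ((3 * (5 + y) + 4) * (3 * (5 + y) + 4))
    expand = solve-∀

  cubic-inequality : ∀ n → 5 ≤ n → 105 * ((2 * n + 6) * (2 * n + 6)) * suc (4 * n) < 304 * suc n * ((3 * n + 4) * (3 * n + 4))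
  cubic-inequality n 5≤n = begin-strict
    105 * ((2 * n + 6) * (2 * n + 6)) * suc (4 * n)     ≡⟨ factor n ⟩
    420 * ((n + 3) * (n + 3)) * suc (4 * n)             <⟨ *-monoʳ-< (420 * ((n + 3) * (n + 3))) 4n+1<4[n+1] ⟩
    420 * ((n + 3) * (n + 3)) * (4 * suc n)             ≡⟨ regroup n ⟩
    16 * suc n * (105 * ((n + 3) * (n + 3)))            ≤⟨ *-monoʳ-≤ (16 * suc n) (quadratic-inequality n 5≤n) ⟩
    16 * suc n * (19 * ((3 * n + 4) * (3 * n + 4)))     ≡⟨ regroup′ (suc n) ((3 * n + 4) * (3 * n + 4)) ⟩
    304 * suc n * ((3 * n + 4) * (3 * n + 4))           ∎
    where
    open ≤-Reasoning
    4n+1<4[n+1] : suc (4 * n) < 4 * suc n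
    4n+1<4[n+1] = subst (suc (4 * n) <_) (sym (*-suc 4 n)) (m<n+m (suc (4 * n)) {3} z<s)
    instance
      n+3≢0 : NonZero (n + 3)
      n+3≢0 = >-nonZero (≤-trans (s≤s z≤n) (m≤n+m 3 n))
      420[n+3]²≢0 : NonZero (420 * ((n + 3) * (n + 3)))
      420[n+3]²≢0 = m*n≢0 420 ((n + 3) * (n + 3)) {{_}} {{m*n≢0 (n + 3) (n + 3)}}
    factor : ∀ n → 105 * ((2 * n + 6) * (2 * n + 6)) * suc (4 * n) ≡ 420 * ((n + 3) * (n + 3)) * suc (4 * n)
    factor = solve-∀
    regroup : ∀ n → 420 * ((n + 3) * (n + 3)) * (4 * suc n) ≡ 16 * suc n * (105 * ((n + 3) * (n + 3)))
    regroup = solve-∀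
    regroup′ : ∀ m q → 16 * m * (19 * q) ≡ 304 * m * q
    regroup′ = solve-∀

  144^[n+1]≡ : ∀ n → 144 ^ suc n ≡ 3 ^ suc n * 3 ^ suc n * (16 * 16 ^ n)
  144^[n+1]≡ n = trans (^-distribʳ-* 9 16 (suc n)) (cong (_* (16 * 16 ^ n)) (^-distribʳ-* 3 3 (suc n)))

  centralTerm₃-inequality : ∀ n → 5 ≤ n →
    105 * 144 ^ suc n * ((2 * n + 6) * suc n * ((2 * n + 6) * suc n) * suc (4 * n))
    < 304 * (16 * suc n ^ 3) * (((3 * n + 4) * centralTerm₃ n) * ((3 * n + 4) * centralTerm₃ n)) * suc (4 * n)
  centralTerm₃-inequality n 5≤n = begin-strict
    105 * 144 ^ suc n * (G * N * (G * N) * E)            ≡⟨ cong (λ x → 105 * x * (G * N * (G * N) * E)) (144^[n+1]≡ n) ⟩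
    105 * (p * p * (16 * s)) * (G * N * (G * N) * E)     ≡⟨ regroup₁ p s G N E ⟩
    K * (105 * (G * G) * E)                              <⟨ *-monoʳ-< K (cubic-inequality n 5≤n) ⟩
    K * (304 * N * (F * F))
      ≤⟨ *-monoˡ-≤ (304 * N * (F * F)) (*-monoˡ-≤ N (*-monoˡ-≤ N (*-monoʳ-≤ (16 * p * p) (central-lower-bound n)))) ⟩
    (16 * p * p * (c * c * E) * N * N) * (304 * N * (F * F)) ≡⟨ regroup₂ p c E N F ⟩
    304 * (16 * N ^ 3) * ((F * (p * c)) * (F * (p * c))) * E ∎
    where
    open ≤-Reasoning
    N = suc n
    G = 2 * n + 6
    F = 3 * n + 4
    E = suc (4 * n)
    c = (n + n) C n
    p = 3 ^ suc n
    s = 16 ^ n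
    K = 16 * p * p * s * N * N
    instance
      K≢0 : NonZero K
      K≢0 = m*n≢0 _ _ {{m*n≢0 _ _ {{m*n≢0 _ _ {{m*n≢0 _ _ {{m*n≢0 16 p {{_}} {{m^n≢0 3 (suc n)}}}} {{m^n≢0 3 (suc n)}}}} {{m^n≢0 16 n}}}}}}
    regroup₁ : ∀ p s G N E → 105 * (p * p * (16 * s)) * (G * N * (G * N) * E) ≡ (16 * p * p * s * N * N) * (105 * (G * G) * E)
    regroup₁ = solve-∀
    regroup₂ : ∀ p c E N F → (16 * p * p * (c * c * E) * N * N) * (304 * N * (F * F))
                             ≡ 304 * (16 * (N * (N * (N * 1)))) * ((F * (p * c)) * (F * (p * c))) * E
    regroup₂ = solve-∀

  excess-inequality-large : ∀ n → 5 ≤ n →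
    105 * 144 ^ suc n < 304 * (16 * suc n ^ 3 * (centralExcess n * centralExcess n))
  excess-inequality-large n 5≤n = *-cancelʳ-< Z (105 * 144 ^ suc n) (304 * (16 * N ^ 3 * (δ * δ))) (begin-strict
    105 * 144 ^ suc n * Z                         <⟨ centralTerm₃-inequality n 5≤n ⟩
    304 * (16 * N ^ 3) * ((F * P) * (F * P)) * E
      ≤⟨ *-monoˡ-≤ E (*-monoʳ-≤ (304 * (16 * N ^ 3)) (*-mono-≤ (centralExcess-bound n) (centralExcess-bound n))) ⟩
    304 * (16 * N ^ 3) * ((A * δ) * (A * δ)) * E  ≡⟨ regroup N A δ E ⟩
    304 * (16 * N ^ 3 * (δ * δ)) * Z              ∎)
    where
    open ≤-Reasoning
    N = suc n
    F = 3 * n + 4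
    E = suc (4 * n)
    A = (2 * n + 6) * N
    P = centralTerm₃ n
    δ = centralExcess n
    Z = A * A * E
    instance
      Z≢0 : NonZero Z
      Z≢0 = m*n≢0 (A * A) E {{m*n≢0 A A {{A≢0}} {{A≢0}}}}
        where A≢0 = m*n≢0 (2 * n + 6) N {{>-nonZero (≤-trans (s≤s z≤n) (m≤n+m 6 (2 * n)))}}
    regroup : ∀ N A δ E → 304 * (16 * (N * (N * (N * 1)))) * ((A * δ) * (A * δ)) * E
                          ≡ 304 * (16 * (N * (N * (N * 1))) * (δ * δ)) * (A * A * E)
    regroup = solve-∀

  -- 16 N³ (closedForm N - ½)² · 304/105 > 1 with denominators cleared (N = n + 1, see closedForm-excess);
  -- the estimate above needs n ≥ 5 and the remaining cases are evaluated.
  excess-inequality : ∀ n → 105 * 144 ^ suc n < 304 * (16 * suc n ^ 3 * (centralExcess n * centralExcess n))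
  excess-inequality 0 = <ᵇ⇒< _ _ tt
  excess-inequality 1 = <ᵇ⇒< _ _ tt
  excess-inequality 2 = <ᵇ⇒< _ _ tt
  excess-inequality 3 = <ᵇ⇒< _ _ tt
  excess-inequality 4 = <ᵇ⇒< _ _ tt
  excess-inequality n@(suc (suc (suc (suc (suc _))))) = excess-inequality-large n (s≤s (s≤s (s≤s (s≤s (s≤s z≤n)))))

  centralTerm₃-pos : ∀ n → 0 < centralTerm₃ n
  centralTerm₃-pos n = *-mono-≤ (m^n>0 3 (suc n)) (0<[k+n]Cn n n)

  centralExcess-pos : ∀ n → 0 < centralExcess n
  centralExcess-pos n = >-nonZero⁻¹ (centralExcess n)
    {{m*n≢0⇒n≢0 ((2 * n + 6) * suc n) {{>-nonZero (≤-trans 0<F*P (centralExcess-bound n))}}}}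
    where
    0<F*P : 0 < (3 * n + 4) * centralTerm₃ n
    0<F*P = *-mono-≤ (≤-trans (s≤s z≤n) (m≤n+m 4 (3 * n))) (centralTerm₃-pos n)

open Binomial
open BinomialEstimates

open import Data.Nat as ℕ using (ℕ; zero; suc; z≤n; s≤s)
import Data.Nat.Properties as ℕ
open import Data.Nat.Combinatorics using (_C_; nCn≡1; k>n⇒nCk≡0)
import Data.Nat.Tactic.RingSolver as ℕ-Solver
open import Data.Nat.Coprimality using (1-coprimeTo) renaming (sym to coprime-sym)
open import Data.Integer as ℤ using (+_; +≤+; +<+)
import Data.Integer.Tactic.RingSolver as ℤ-Solver
open import Data.Rational
  using (ℚ; mkℚ; 0ℚ; 1ℚ; ½; _+_; _*_; _-_; -_; _/_; _≤_; _<_; ∣_∣; *≤*; *<*; toℚᵘ; nonNegative; positive)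
open import Data.Rational.Properties
import Data.Rational.Unnormalised as ℚᵘ
import Data.Rational.Unnormalised.Properties as ℚᵘ
open import Data.List using (List)
open import Data.Product using (_×_; _,_; proj₁; proj₂; ∃)
open import Relation.Binary.PropositionalEquality
open import Relation.Nullary.Decidable using (toWitness; dec⇒maybe)
open import Tactic.RingSolver using (solve-∀)
open import Tactic.RingSolver.Core.AlmostCommutativeRing using (AlmostCommutativeRing; fromCommutativeRing)

-- Rational arithmetic: casts, powers and finite sums

ℚ-ring : AlmostCommutativeRing _ _
ℚ-ring = fromCommutativeRing +-*-commutativeRing (λ x → dec⇒maybe (0ℚ ≟ x))

¼ ¾ ⅓ 4/3 1/12 : ℚ
¼ = + 1 / 4
¾ = + 3 / 4
⅓ = + 1 / 3
4/3 = + 4 / 3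
1/12 = + 1 / 12

0≤½ : 0ℚ ≤ ½
0≤½ = toWitness {a? = 0ℚ ≤? ½} _
½≤1 : ½ ≤ 1ℚ
½≤1 = toWitness {a? = ½ ≤? 1ℚ} _
0≤¼ : 0ℚ ≤ ¼
0≤¼ = toWitness {a? = 0ℚ ≤? ¼} _
0≤¾ : 0ℚ ≤ ¾
0≤¾ = toWitness {a? = 0ℚ ≤? ¾} _
¾≤1 : ¾ ≤ 1ℚ
¾≤1 = toWitness {a? = ¾ ≤? 1ℚ} _

ℕ→ℚ≡mkℚ : ∀ n → ℕ→ℚ n ≡ mkℚ (+ n) 0 (coprime-sym (1-coprimeTo n))
ℕ→ℚ≡mkℚ n = normalize-coprime (coprime-sym (1-coprimeTo n))

ℕ→ℚ-suc : ∀ n → ℕ→ℚ (suc n) ≡ 1ℚ + ℕ→ℚ n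
ℕ→ℚ-suc n = toℚᵘ-injective (begin
  toℚᵘ (ℕ→ℚ (suc n))                  ≡⟨ cong toℚᵘ (ℕ→ℚ≡mkℚ (suc n)) ⟩
  ℚᵘ.mkℚᵘ (+ suc n) 0                 ≈⟨ ℚᵘ.*≡* (cross-multiply (+ n)) ⟩
  ℚᵘ.mkℚᵘ (+ 1) 0 ℚᵘ.+ ℚᵘ.mkℚᵘ (+ n) 0 ≡⟨ sym (cong₂ ℚᵘ._+_ (cong toℚᵘ (ℕ→ℚ≡mkℚ 1)) (cong toℚᵘ (ℕ→ℚ≡mkℚ n))) ⟩
  toℚᵘ 1ℚ ℚᵘ.+ toℚᵘ (ℕ→ℚ n)           ≈⟨ ℚᵘ.≃-sym (toℚᵘ-homo-+ 1ℚ (ℕ→ℚ n)) ⟩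
  toℚᵘ (1ℚ + ℕ→ℚ n)                   ∎)
  where
  open import Relation.Binary.Reasoning.Setoid ℚᵘ.≃-setoid
  cross-multiply : ∀ x → (+ 1 ℤ.+ x) ℤ.* + 1 ≡ (+ 1 ℤ.* + 1 ℤ.+ x ℤ.* + 1) ℤ.* + 1
  cross-multiply = ℤ-Solver.solve-∀

ℕ→ℚ-+ : ∀ m n → ℕ→ℚ (m ℕ.+ n) ≡ ℕ→ℚ m + ℕ→ℚ n
ℕ→ℚ-+ zero    n = sym (+-identityˡ (ℕ→ℚ n))
ℕ→ℚ-+ (suc m) n = begin
  ℕ→ℚ (suc (m ℕ.+ n))        ≡⟨ ℕ→ℚ-suc (m ℕ.+ n) ⟩
  1ℚ + ℕ→ℚ (m ℕ.+ n)         ≡⟨ cong (_+_ 1ℚ) (ℕ→ℚ-+ m n) ⟩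
  1ℚ + (ℕ→ℚ m + ℕ→ℚ n)       ≡⟨ sym (+-assoc 1ℚ (ℕ→ℚ m) (ℕ→ℚ n)) ⟩
  (1ℚ + ℕ→ℚ m) + ℕ→ℚ n       ≡⟨ cong (_+ ℕ→ℚ n) (sym (ℕ→ℚ-suc m)) ⟩
  ℕ→ℚ (suc m) + ℕ→ℚ n        ∎
  where open ≡-Reasoning

ℕ→ℚ-* : ∀ m n → ℕ→ℚ (m ℕ.* n) ≡ ℕ→ℚ m * ℕ→ℚ n
ℕ→ℚ-* zero    n = sym (*-zeroˡ (ℕ→ℚ n))
ℕ→ℚ-* (suc m) n = begin
  ℕ→ℚ (n ℕ.+ m ℕ.* n)        ≡⟨ ℕ→ℚ-+ n (m ℕ.* n) ⟩
  ℕ→ℚ n + ℕ→ℚ (m ℕ.* n)      ≡⟨ cong (_+_ (ℕ→ℚ n)) (ℕ→ℚ-* m n) ⟩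
  ℕ→ℚ n + ℕ→ℚ m * ℕ→ℚ n      ≡⟨ cong (_+ ℕ→ℚ m * ℕ→ℚ n) (sym (*-identityˡ (ℕ→ℚ n))) ⟩
  1ℚ * ℕ→ℚ n + ℕ→ℚ m * ℕ→ℚ n ≡⟨ sym (*-distribʳ-+ (ℕ→ℚ n) 1ℚ (ℕ→ℚ m)) ⟩
  (1ℚ + ℕ→ℚ m) * ℕ→ℚ n       ≡⟨ cong (_* ℕ→ℚ n) (sym (ℕ→ℚ-suc m)) ⟩
  ℕ→ℚ (suc m) * ℕ→ℚ n        ∎
  where open ≡-Reasoning

ℕ→ℚ-^ : ∀ m n → ℕ→ℚ (m ℕ.^ n) ≡ ℕ→ℚ m ^ℚ n
ℕ→ℚ-^ m zero    = refl
ℕ→ℚ-^ m (suc n) = trans (ℕ→ℚ-* m (m ℕ.^ n)) (cong (ℕ→ℚ m *_) (ℕ→ℚ-^ m n))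

ℕ→ℚ-Σℕ< : ∀ n f → ℕ→ℚ (Σℕ< n f) ≡ Σ< n (λ k → ℕ→ℚ (f k))
ℕ→ℚ-Σℕ< zero    f = refl
ℕ→ℚ-Σℕ< (suc n) f = trans (ℕ→ℚ-+ (Σℕ< n f) (f n)) (cong (_+ ℕ→ℚ (f n)) (ℕ→ℚ-Σℕ< n f))

ℕ→ℚ-nonNeg : ∀ n → 0ℚ ≤ ℕ→ℚ n
ℕ→ℚ-nonNeg n = nonNegative⁻¹ (ℕ→ℚ n) {{normalize-nonNeg n 1}}

p≤p+q : ∀ p {q} → 0ℚ ≤ q → p ≤ p + q
p≤p+q p 0≤q = subst (_≤ p + _) (+-identityʳ p) (+-monoʳ-≤ p 0≤q)

ℕ→ℚ-mono-≤ : ∀ {m n} → m ℕ.≤ n → ℕ→ℚ m ≤ ℕ→ℚ n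
ℕ→ℚ-mono-≤ {m} m≤n with ℕ.m≤n⇒∃[o]m+o≡n m≤n
... | k , refl = subst (ℕ→ℚ m ≤_) (sym (ℕ→ℚ-+ m k)) (p≤p+q (ℕ→ℚ m) (ℕ→ℚ-nonNeg k))

ℕ→ℚ-mono-< : ∀ {m n} → m ℕ.< n → ℕ→ℚ m < ℕ→ℚ n
ℕ→ℚ-mono-< {m} m<n = <-≤-trans m<1+m (ℕ→ℚ-mono-≤ m<n)
  where
  m<1+m : ℕ→ℚ m < ℕ→ℚ (suc m)
  m<1+m = subst₂ _<_ (+-identityˡ (ℕ→ℚ m)) (sym (ℕ→ℚ-suc m))
            (+-monoˡ-< (ℕ→ℚ m) (toWitness {a? = 0ℚ <? 1ℚ} _))

a≡[a+b]-b : ∀ a b → a ≡ (a + b) - b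
a≡[a+b]-b = solve-∀ ℚ-ring

*-nonNeg : ∀ {p q} → 0ℚ ≤ p → 0ℚ ≤ q → 0ℚ ≤ p * q
*-nonNeg {p} {q} 0≤p 0≤q = subst (_≤ p * q) (*-zeroˡ q) (*-monoʳ-≤-nonNeg q {{nonNegative 0≤q}} 0≤p)

*-mono-≤-nonNeg : ∀ {a b c d} → 0ℚ ≤ a → 0ℚ ≤ c → a ≤ b → c ≤ d → a * c ≤ b * d
*-mono-≤-nonNeg {a} {b} {c} {d} 0≤a 0≤c a≤b c≤d =
  ≤-trans (*-monoʳ-≤-nonNeg c {{nonNegative 0≤c}} a≤b)
          (*-monoˡ-≤-nonNeg b {{nonNegative (≤-trans 0≤a a≤b)}} c≤d)

^ℚ-+ : ∀ q m n → q ^ℚ (m ℕ.+ n) ≡ q ^ℚ m * q ^ℚ n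
^ℚ-+ q zero    n = sym (*-identityˡ (q ^ℚ n))
^ℚ-+ q (suc m) n = trans (cong (q *_) (^ℚ-+ q m n)) (sym (*-assoc q (q ^ℚ m) (q ^ℚ n)))

^ℚ-distrib-* : ∀ p q n → (p * q) ^ℚ n ≡ p ^ℚ n * q ^ℚ n
^ℚ-distrib-* p q zero    = refl
^ℚ-distrib-* p q (suc n) = trans (cong ((p * q) *_) (^ℚ-distrib-* p q n)) (interchange p q (p ^ℚ n) (q ^ℚ n))
  where
  interchange : ∀ a b c d → (a * b) * (c * d) ≡ (a * c) * (b * d)
  interchange = solve-∀ ℚ-ring

1^ℚ : ∀ n → 1ℚ ^ℚ n ≡ 1ℚ
1^ℚ zero    = refl
1^ℚ (suc n) = trans (*-identityˡ (1ℚ ^ℚ n)) (1^ℚ n)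

^ℚ-inverse : ∀ {p q} n → p * q ≡ 1ℚ → p ^ℚ n * q ^ℚ n ≡ 1ℚ
^ℚ-inverse {p} {q} n pq≡1 = trans (sym (^ℚ-distrib-* p q n)) (trans (cong (_^ℚ n) pq≡1) (1^ℚ n))

^ℚ-nonNeg : ∀ {q} n → 0ℚ ≤ q → 0ℚ ≤ q ^ℚ n
^ℚ-nonNeg zero    _   = toWitness {a? = 0ℚ ≤? 1ℚ} _
^ℚ-nonNeg (suc n) 0≤q = *-nonNeg 0≤q (^ℚ-nonNeg n 0≤q)

^ℚ-pos : ∀ {q} n → 0ℚ < q → 0ℚ < q ^ℚ n
^ℚ-pos zero    _   = toWitness {a? = 0ℚ <? 1ℚ} _
^ℚ-pos {q} (suc n) 0<q = positive⁻¹ (q * q ^ℚ n)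
  {{pos*pos⇒pos q {{positive 0<q}} (q ^ℚ n) {{positive (^ℚ-pos n 0<q)}}}}

^ℚ-≤1 : ∀ {q} n → 0ℚ ≤ q → q ≤ 1ℚ → q ^ℚ n ≤ 1ℚ
^ℚ-≤1 zero    _   _   = ≤-refl
^ℚ-≤1 {q} (suc n) 0≤q q≤1 =
  subst (q * q ^ℚ n ≤_) (*-identityˡ 1ℚ) (*-mono-≤-nonNeg 0≤q (^ℚ-nonNeg n 0≤q) q≤1 (^ℚ-≤1 n 0≤q q≤1))

^ℚ-antitone : ∀ {q} k m → 0ℚ ≤ q → q ≤ 1ℚ → q ^ℚ (k ℕ.+ m) ≤ q ^ℚ m
^ℚ-antitone {q} k m 0≤q q≤1 = begin
  q ^ℚ (k ℕ.+ m)     ≡⟨ ^ℚ-+ q k m ⟩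
  q ^ℚ k * q ^ℚ m    ≤⟨ *-monoʳ-≤-nonNeg (q ^ℚ m) {{nonNegative (^ℚ-nonNeg m 0≤q)}} (^ℚ-≤1 k 0≤q q≤1) ⟩
  1ℚ * q ^ℚ m        ≡⟨ *-identityˡ (q ^ℚ m) ⟩
  q ^ℚ m             ∎
  where open ≤-Reasoning

^ℚ-scaled : ∀ a q t → (ℕ→ℚ a * q) ^ℚ t ≡ ℕ→ℚ (a ℕ.^ t) * q ^ℚ t
^ℚ-scaled a q t = trans (^ℚ-distrib-* (ℕ→ℚ a) q t) (cong (_* q ^ℚ t) (sym (ℕ→ℚ-^ a t)))

Σ<-cong : ∀ n {f g : ℕ → ℚ} → (∀ k → f k ≡ g k) → Σ< n f ≡ Σ< n g
Σ<-cong zero    f≗g = refl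
Σ<-cong (suc n) f≗g = cong₂ _+_ (Σ<-cong n f≗g) (f≗g n)

Σ<-cong-< : ∀ n {f g : ℕ → ℚ} → (∀ k → k ℕ.< n → f k ≡ g k) → Σ< n f ≡ Σ< n g
Σ<-cong-< zero    f≗g = refl
Σ<-cong-< (suc n) f≗g = cong₂ _+_ (Σ<-cong-< n (λ k k<n → f≗g k (ℕ.m<n⇒m<1+n k<n))) (f≗g n ℕ.≤-refl)

Σ<-zero : ∀ n {f : ℕ → ℚ} → (∀ k → k ℕ.< n → f k ≡ 0ℚ) → Σ< n f ≡ 0ℚ
Σ<-zero zero    f≡0 = refl
Σ<-zero (suc n) f≡0 =
  trans (cong₂ _+_ (Σ<-zero n (λ k k<n → f≡0 k (ℕ.m<n⇒m<1+n k<n))) (f≡0 n ℕ.≤-refl)) (+-identityʳ 0ℚ)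

Σ<-- : ∀ n (f g : ℕ → ℚ) → Σ< n (λ k → f k - g k) ≡ Σ< n f - Σ< n g
Σ<-- zero    f g = refl
Σ<-- (suc n) f g = trans (cong (_+ (f n - g n)) (Σ<-- n f g)) (interchange (Σ< n f) (Σ< n g) (f n) (g n))
  where
  interchange : ∀ a b c d → (a - b) + (c - d) ≡ (a + c) - (b + d)
  interchange = solve-∀ ℚ-ring

Σ<-*ˡ : ∀ n c (f : ℕ → ℚ) → c * Σ< n f ≡ Σ< n (λ k → c * f k)
Σ<-*ˡ zero    c f = *-zeroʳ c
Σ<-*ˡ (suc n) c f = trans (*-distribˡ-+ c (Σ< n f) (f n)) (cong (_+ c * f n) (Σ<-*ˡ n c f))

Σ<-*ʳ : ∀ n (f : ℕ → ℚ) c → Σ< n f * c ≡ Σ< n (λ k → f k * c)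
Σ<-*ʳ n f c = trans (*-comm (Σ< n f) c) (trans (Σ<-*ˡ n c f) (Σ<-cong n (λ k → *-comm c (f k))))

Σ<-unconsˡ : ∀ n (f : ℕ → ℚ) → Σ< (suc n) f ≡ f 0 + Σ< n (λ k → f (suc k))
Σ<-unconsˡ zero    f = trans (+-identityˡ (f 0)) (sym (+-identityʳ (f 0)))
Σ<-unconsˡ (suc n) f =
  trans (cong (_+ f (suc n)) (Σ<-unconsˡ n f)) (+-assoc (f 0) (Σ< n (λ k → f (suc k))) (f (suc n)))

Σ<-split : ∀ m n (f : ℕ → ℚ) → Σ< (m ℕ.+ n) f ≡ Σ< m f + Σ< n (λ k → f (m ℕ.+ k))
Σ<-split m zero    f = trans (cong (λ z → Σ< z f) (ℕ.+-identityʳ m)) (sym (+-identityʳ (Σ< m f)))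
Σ<-split m (suc n) f = begin
  Σ< (m ℕ.+ suc n) f                                   ≡⟨ cong (λ z → Σ< z f) (ℕ.+-suc m n) ⟩
  Σ< (m ℕ.+ n) f + f (m ℕ.+ n)                         ≡⟨ cong (_+ f (m ℕ.+ n)) (Σ<-split m n f) ⟩
  (Σ< m f + Σ< n (λ k → f (m ℕ.+ k))) + f (m ℕ.+ n)   ≡⟨ +-assoc (Σ< m f) _ (f (m ℕ.+ n)) ⟩
  Σ< m f + Σ< (suc n) (λ k → f (m ℕ.+ k))              ∎
  where open ≡-Reasoning

Σ<-from : ∀ n r (f : ℕ → ℚ) → Σ< r (λ t → f (n ℕ.+ t)) ≡ Σ< (n ℕ.+ r) f - Σ< n f
Σ<-from n r f = trans (a≡b+a-b (Σ< n f) _) (cong (_- Σ< n f) (sym (Σ<-split n r f)))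
  where
  a≡b+a-b : ∀ b a → a ≡ (b + a) - b
  a≡b+a-b = solve-∀ ℚ-ring

Σ<-reverse : ∀ n (f : ℕ → ℚ) → Σ< n f ≡ Σ< n (λ k → f (n ℕ.∸ suc k))
Σ<-reverse zero    f = refl
Σ<-reverse (suc n) f = begin
  Σ< n f + f n                              ≡⟨ +-comm (Σ< n f) (f n) ⟩
  f n + Σ< n f                              ≡⟨ cong (_+_ (f n)) (Σ<-reverse n f) ⟩
  f n + Σ< n (λ k → f (n ℕ.∸ suc k))        ≡⟨ sym (Σ<-unconsˡ n (λ k → f (n ℕ.∸ k))) ⟩
  Σ< (suc n) (λ k → f (n ℕ.∸ k))            ∎
  where open ≡-Reasoning

Σ<-mono-≤ : ∀ n {f g : ℕ → ℚ} → (∀ k → f k ≤ g k) → Σ< n f ≤ Σ< n g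
Σ<-mono-≤ zero    f≤g = ≤-refl
Σ<-mono-≤ (suc n) f≤g = +-mono-≤ (Σ<-mono-≤ n f≤g) (f≤g n)

Σ<-nonNeg : ∀ n {f : ℕ → ℚ} → (∀ k → 0ℚ ≤ f k) → 0ℚ ≤ Σ< n f
Σ<-nonNeg n {f} 0≤f = subst (_≤ Σ< n f) (Σ<-zero n (λ _ _ → refl)) (Σ<-mono-≤ n 0≤f)

-- Coefficient sequences, series and the product matrix

-- A sequence u stands for the power series Σ uₖ xᵏ: δ₀ is 1, 𝟙 is 1/(1 - x), shift is multiplication by x,
-- negBinom n is (1 - x)⁻ⁿ and geometricFrom n is xⁿ/(1 - x).

Seq : Set
Seq = ℕ → ℚ

_⋆_ : Seq → Seq → Seq
(u ⋆ v) n = Σ≤ n (λ k → u k * v (n ℕ.∸ k))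

_⊠_ : Seq → Seq → Series
(u ⊠ v) i j = u i * v j

δ₀ 𝟙 : Seq
δ₀ zero    = 1ℚ
δ₀ (suc _) = 0ℚ
𝟙 _ = 1ℚ

shift : Seq → Seq
shift u zero    = 0ℚ
shift u (suc n) = u n

negBinom : ℕ → Seq
negBinom zero      = δ₀
negBinom (suc n) k = ℕ→ℚ ((k ℕ.+ n) C n)

geometricFrom : ℕ → Seq
geometricFrom zero    = 𝟙
geometricFrom (suc n) = shift (geometricFrom n)

shift-cong : ∀ {u v} → u ≗ v → shift u ≗ shift v
shift-cong u≗v zero    = refl
shift-cong u≗v (suc k) = u≗v k

shift-+ : ∀ u v k → shift u k + shift v k ≡ shift (λ i → u i + v i) k
shift-+ u v zero    = refl
shift-+ u v (suc k) = refl

⋆-comm : ∀ u v → (u ⋆ v) ≗ (v ⋆ u)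
⋆-comm u v n = begin
  Σ< (suc n) (λ k → u k * v (n ℕ.∸ k))                        ≡⟨ Σ<-reverse (suc n) _ ⟩
  Σ< (suc n) (λ k → u (n ℕ.∸ k) * v (n ℕ.∸ (n ℕ.∸ k)))        ≡⟨ Σ<-cong-< (suc n) swap ⟩
  Σ< (suc n) (λ k → v k * u (n ℕ.∸ k))                        ∎
  where
  open ≡-Reasoning
  swap : ∀ k → k ℕ.< suc n → u (n ℕ.∸ k) * v (n ℕ.∸ (n ℕ.∸ k)) ≡ v k * u (n ℕ.∸ k)
  swap k (s≤s k≤n) = trans (*-comm (u (n ℕ.∸ k)) _) (cong (λ i → v i * u (n ℕ.∸ k)) (ℕ.m∸[m∸n]≡n k≤n))

⋆-identityˡ : ∀ v → (δ₀ ⋆ v) ≗ v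
⋆-identityˡ v n = begin
  Σ< (suc n) (λ k → δ₀ k * v (n ℕ.∸ k))           ≡⟨ Σ<-unconsˡ n _ ⟩
  1ℚ * v n + Σ< n (λ k → 0ℚ * v (n ℕ.∸ suc k))    ≡⟨ cong₂ _+_ (*-identityˡ (v n)) (Σ<-zero n (λ k _ → *-zeroˡ (v (n ℕ.∸ suc k)))) ⟩
  v n + 0ℚ                                        ≡⟨ +-identityʳ (v n) ⟩
  v n                                             ∎
  where open ≡-Reasoning

⋆-identityʳ : ∀ u → (u ⋆ δ₀) ≗ u
⋆-identityʳ u n = trans (⋆-comm u δ₀ n) (⋆-identityˡ u n)

⋆-shiftˡ : ∀ u v → (shift u ⋆ v) ≗ shift (u ⋆ v)
⋆-shiftˡ u v zero    = trans (+-identityˡ _) (*-zeroˡ (v 0))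
⋆-shiftˡ u v (suc n) = trans (Σ<-unconsˡ (suc n) _) (trans (cong (_+ (u ⋆ v) n) (*-zeroˡ (v (suc n)))) (+-identityˡ _))

⋆-shiftʳ : ∀ u v → (u ⋆ shift v) ≗ shift (u ⋆ v)
⋆-shiftʳ u v zero    = trans (⋆-comm u (shift v) 0) (⋆-shiftˡ v u 0)
⋆-shiftʳ u v (suc n) = trans (⋆-comm u (shift v) (suc n)) (trans (⋆-shiftˡ v u (suc n)) (⋆-comm v u n))

shiftδ₀-⋆ : ∀ v → (shift δ₀ ⋆ v) ≗ shift v
shiftδ₀-⋆ v k = trans (⋆-shiftˡ δ₀ v k) (shift-cong (⋆-identityˡ v) k)

𝟙⋆-partialSum : ∀ v → (𝟙 ⋆ v) ≗ (λ n → Σ≤ n v)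
𝟙⋆-partialSum v n = trans (⋆-comm 𝟙 v n) (Σ<-cong (suc n) (λ k → *-identityʳ (v k)))

negBinom-head : ∀ n → negBinom n 0 ≡ 1ℚ
negBinom-head zero    = refl
negBinom-head (suc n) = cong ℕ→ℚ (nCn≡1 n)

negBinom-pascal : ∀ n k → shift (negBinom (suc n)) k + negBinom n k ≡ negBinom (suc n) k
negBinom-pascal n       zero    = trans (+-identityˡ (negBinom n 0)) (trans (negBinom-head n) (sym (negBinom-head (suc n))))
negBinom-pascal zero    (suc k) = refl
negBinom-pascal (suc n) (suc k) = trans (sym (ℕ→ℚ-+ ((k ℕ.+ suc n) C suc n) ((suc k ℕ.+ n) C n))) (cong ℕ→ℚ (begin
  (k ℕ.+ suc n) C suc n ℕ.+ (suc k ℕ.+ n) C n        ≡⟨ ℕ.+-comm ((k ℕ.+ suc n) C suc n) _ ⟩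
  (suc k ℕ.+ n) C n ℕ.+ (k ℕ.+ suc n) C suc n        ≡⟨ cong (λ m → m C n ℕ.+ (k ℕ.+ suc n) C suc n) (sym (ℕ.+-suc k n)) ⟩
  (k ℕ.+ suc n) C n ℕ.+ (k ℕ.+ suc n) C suc n        ≡⟨ sym (pascal (k ℕ.+ suc n) n) ⟩
  (suc k ℕ.+ suc n) C suc n                          ∎))
  where open ≡-Reasoning

negBinom-partialSum : ∀ n k → Σ≤ k (negBinom n) ≡ negBinom (suc n) k
negBinom-partialSum n zero    = negBinom-pascal n 0
negBinom-partialSum n (suc k) =
  trans (cong (_+ negBinom n (suc k)) (negBinom-partialSum n k)) (negBinom-pascal n (suc k))

𝟙⋆shift-negBinom : ∀ n → (𝟙 ⋆ shift (negBinom n)) ≗ shift (negBinom (suc n))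
𝟙⋆shift-negBinom n k = trans (⋆-shiftʳ 𝟙 (negBinom n) k)
  (shift-cong (λ i → trans (𝟙⋆-partialSum (negBinom n) i) (negBinom-partialSum n i)) k)

shift-negBinom-pascal : ∀ n → (λ k → shift (shift (negBinom (suc n))) k + shift (negBinom n) k) ≗ shift (negBinom (suc n))
shift-negBinom-pascal n k = trans (shift-+ _ _ k) (shift-cong (negBinom-pascal n) k)

_≈ₛ_ : Series → Series → Set
f ≈ₛ g = ∀ i j → f i j ≡ g i j

≈ₛ-trans : ∀ {f g h} → f ≈ₛ g → g ≈ₛ h → f ≈ₛ h
≈ₛ-trans f≈g g≈h i j = trans (f≈g i j) (g≈h i j)

+s-cong : ∀ {f f′ g g′} → f ≈ₛ f′ → g ≈ₛ g′ → (f +s g) ≈ₛ (f′ +s g′)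
+s-cong f≈f′ g≈g′ i j = cong₂ _+_ (f≈f′ i j) (g≈g′ i j)

*s-cong : ∀ {f f′ g g′} → f ≈ₛ f′ → g ≈ₛ g′ → (f *s g) ≈ₛ (f′ *s g′)
*s-cong f≈f′ g≈g′ i j =
  Σ<-cong (suc i) (λ a → Σ<-cong (suc j) (λ b → cong₂ _*_ (f≈f′ a b) (g≈g′ (i ℕ.∸ a) (j ℕ.∸ b))))

⊠-cong : ∀ {u u′ v v′} → u ≗ u′ → v ≗ v′ → (u ⊠ v) ≈ₛ (u′ ⊠ v′)
⊠-cong u≗u′ v≗v′ i j = cong₂ _*_ (u≗u′ i) (v≗v′ j)

+s-identityˡ : ∀ {f g} → f ≈ₛ 0s → (f +s g) ≈ₛ g
+s-identityˡ {g = g} f≈0 i j = trans (cong (_+ g i j) (f≈0 i j)) (+-identityˡ (g i j))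

+s-identityʳ : ∀ {f g} → g ≈ₛ 0s → (f +s g) ≈ₛ f
+s-identityʳ {f} g≈0 i j = trans (cong (_+_ (f i j)) (g≈0 i j)) (+-identityʳ (f i j))

⊠-distribʳ-+s : ∀ u u′ v → ((u ⊠ v) +s (u′ ⊠ v)) ≈ₛ ((λ k → u k + u′ k) ⊠ v)
⊠-distribʳ-+s u u′ v i j = sym (*-distribʳ-+ (v j) (u i) (u′ i))

*s-zeroˡ : ∀ g → (0s *s g) ≈ₛ 0s
*s-zeroˡ g i j = Σ<-zero (suc i) (λ a _ → Σ<-zero (suc j) (λ b _ → *-zeroˡ (g (i ℕ.∸ a) (j ℕ.∸ b))))

*s-zeroʳ : ∀ f → (f *s 0s) ≈ₛ 0s
*s-zeroʳ f i j = Σ<-zero (suc i) (λ a _ → Σ<-zero (suc j) (λ b _ → *-zeroʳ (f a b)))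

*s-⊠ : ∀ u v u′ v′ → ((u ⊠ v) *s (u′ ⊠ v′)) ≈ₛ ((u ⋆ u′) ⊠ (v ⋆ v′))
*s-⊠ u v u′ v′ i j = begin
  Σ≤ i (λ a → Σ≤ j (λ b → (u a * v b) * (u′ (i ℕ.∸ a) * v′ (j ℕ.∸ b))))
    ≡⟨ Σ<-cong (suc i) (λ a → Σ<-cong (suc j) (λ b → interchange (u a) (v b) _ _)) ⟩
  Σ≤ i (λ a → Σ≤ j (λ b → (u a * u′ (i ℕ.∸ a)) * (v b * v′ (j ℕ.∸ b))))
    ≡⟨ Σ<-cong (suc i) (λ a → sym (Σ<-*ˡ (suc j) (u a * u′ (i ℕ.∸ a)) _)) ⟩
  Σ≤ i (λ a → (u a * u′ (i ℕ.∸ a)) * (v ⋆ v′) j)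
    ≡⟨ sym (Σ<-*ʳ (suc i) _ _) ⟩
  (u ⋆ u′) i * (v ⋆ v′) j
    ∎
  where
  open ≡-Reasoning
  interchange : ∀ a b c d → (a * b) * (c * d) ≡ (a * c) * (b * d)
  interchange = solve-∀ ℚ-ring

*s-sep : ∀ {f g} u v u′ v′ → f ≈ₛ (u ⊠ v) → g ≈ₛ (u′ ⊠ v′) → (f *s g) ≈ₛ ((u ⋆ u′) ⊠ (v ⋆ v′))
*s-sep u v u′ v′ f≈ g≈ = ≈ₛ-trans (*s-cong f≈ g≈) (*s-⊠ u v u′ v′)

1s≈ : 1s ≈ₛ (δ₀ ⊠ δ₀)
1s≈ zero    zero    = refl
1s≈ zero    (suc j) = refl
1s≈ (suc i) j       = sym (*-zeroˡ (δ₀ j))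

αs≈ : αs ≈ₛ (shift δ₀ ⊠ δ₀)
αs≈ zero          j       = sym (*-zeroˡ (δ₀ j))
αs≈ (suc zero)    zero    = refl
αs≈ (suc zero)    (suc j) = refl
αs≈ (suc (suc i)) j       = sym (*-zeroˡ (δ₀ j))

βs≈ : βs ≈ₛ (δ₀ ⊠ shift δ₀)
βs≈ zero    zero          = refl
βs≈ zero    (suc zero)    = refl
βs≈ zero    (suc (suc j)) = refl
βs≈ (suc i) j             = sym (*-zeroˡ (shift δ₀ j))

α/1-β≈ : α/1-β ≈ₛ (shift δ₀ ⊠ 𝟙)
α/1-β≈ zero          j = refl
α/1-β≈ (suc zero)    j = refl
α/1-β≈ (suc (suc i)) j = refl

β/1-α≈ : β/1-α ≈ₛ (𝟙 ⊠ shift δ₀)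
β/1-α≈ i zero          = refl
β/1-α≈ i (suc zero)    = refl
β/1-α≈ i (suc (suc j)) = refl

*s-identityʳ : ∀ f → (f *s 1s) ≈ₛ f
*s-identityʳ f i j = begin
  Σ≤ i (λ a → Σ≤ j (λ b → f a b * 1s (i ℕ.∸ a) (j ℕ.∸ b)))
    ≡⟨ Σ<-cong (suc i) (λ a → Σ<-cong (suc j) (λ b → regroup (f a b) (i ℕ.∸ a) (j ℕ.∸ b))) ⟩
  Σ≤ i (λ a → Σ≤ j (λ b → δ₀ (i ℕ.∸ a) * (f a b * δ₀ (j ℕ.∸ b))))
    ≡⟨ Σ<-cong (suc i) (λ a → sym (Σ<-*ˡ (suc j) (δ₀ (i ℕ.∸ a)) _)) ⟩
  Σ≤ i (λ a → δ₀ (i ℕ.∸ a) * (f a ⋆ δ₀) j)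
    ≡⟨ Σ<-cong (suc i) (λ a → trans (*-comm (δ₀ (i ℕ.∸ a)) _) (cong (_* δ₀ (i ℕ.∸ a)) (⋆-identityʳ (f a) j))) ⟩
  ((λ a → f a j) ⋆ δ₀) i
    ≡⟨ ⋆-identityʳ (λ a → f a j) i ⟩
  f i j
    ∎
  where
  open ≡-Reasoning
  swap : ∀ x a b → x * (a * b) ≡ a * (x * b)
  swap = solve-∀ ℚ-ring
  regroup : ∀ x a b → x * 1s a b ≡ δ₀ a * (x * δ₀ b)
  regroup x a b = trans (cong (x *_) (1s≈ a b)) (swap x (δ₀ a) (δ₀ b))

_≈M_ : Mat → Mat → Set
M ≈M K = (m00 M ≈ₛ m00 K) × (m01 M ≈ₛ m01 K) × (m10 M ≈ₛ m10 K) × (m11 M ≈ₛ m11 K)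

≈M-refl : ∀ {M} → M ≈M M
≈M-refl = (λ _ _ → refl) , (λ _ _ → refl) , (λ _ _ → refl) , (λ _ _ → refl)

≈M-trans : ∀ {M K L} → M ≈M K → K ≈M L → M ≈M L
≈M-trans (a , b , c , d) (a′ , b′ , c′ , d′) = ≈ₛ-trans a a′ , ≈ₛ-trans b b′ , ≈ₛ-trans c c′ , ≈ₛ-trans d d′

⊗-cong : ∀ {M M′ K K′} → M ≈M M′ → K ≈M K′ → (M ⊗ K) ≈M (M′ ⊗ K′)
⊗-cong (a , b , c , d) (a′ , b′ , c′ , d′) =
  +s-cong (*s-cong a a′) (*s-cong b c′) , +s-cong (*s-cong a b′) (*s-cong b d′) ,
  +s-cong (*s-cong c a′) (*s-cong d c′) , +s-cong (*s-cong c b′) (*s-cong d d′)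

⊗-identityʳ : ∀ M → (M ⊗ I₂) ≈M M
⊗-identityʳ (mat a b c d) =
  ≈ₛ-trans (+s-identityʳ (*s-zeroʳ b)) (*s-identityʳ a) , ≈ₛ-trans (+s-identityˡ (*s-zeroʳ a)) (*s-identityʳ b) ,
  ≈ₛ-trans (+s-identityʳ (*s-zeroʳ d)) (*s-identityʳ c) , ≈ₛ-trans (+s-identityˡ (*s-zeroʳ c)) (*s-identityʳ d)

⊗-zeroColumn : ∀ M f g →
  (M ⊗ mat f 0s g 0s) ≈M mat ((m00 M *s f) +s (m01 M *s g)) 0s ((m10 M *s f) +s (m11 M *s g)) 0s
⊗-zeroColumn (mat a b c d) f g =
  (λ _ _ → refl) , ≈ₛ-trans (+s-identityˡ (*s-zeroʳ a)) (*s-zeroʳ b) ,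
  (λ _ _ → refl) , ≈ₛ-trans (+s-identityˡ (*s-zeroʳ c)) (*s-zeroʳ d)

A₁∞⊗K≈ : ∀ K → (A₁∞ ⊗ K) ≈M mat (β/1-α *s m10 K) (β/1-α *s m11 K) (1s *s m10 K) (1s *s m11 K)
A₁∞⊗K≈ K = +s-identityˡ (*s-zeroˡ (m00 K)) , +s-identityˡ (*s-zeroˡ (m01 K)) ,
           +s-identityˡ (*s-zeroˡ (m00 K)) , +s-identityˡ (*s-zeroˡ (m01 K))

A₁∞A₀-sep : Mat
A₁∞A₀-sep = mat (shift 𝟙 ⊠ shift δ₀) (𝟙 ⊠ shift (shift δ₀)) (shift δ₀ ⊠ δ₀) (δ₀ ⊠ shift δ₀)

A₁∞⊗A₀≈ : (A₁∞ ⊗ (A₀ ⊗ I₂)) ≈M A₁∞A₀-sep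
A₁∞⊗A₀≈ = ≈M-trans (⊗-cong {A₁∞} ≈M-refl (⊗-identityʳ A₀)) (≈M-trans (A₁∞⊗K≈ A₀)
  ( ≈ₛ-trans (*s-sep 𝟙 (shift δ₀) (shift δ₀) δ₀ β/1-α≈ αs≈) (⊠-cong (𝟙⋆shift-negBinom 0) (⋆-identityʳ (shift δ₀)))
  , ≈ₛ-trans (*s-sep 𝟙 (shift δ₀) δ₀ (shift δ₀) β/1-α≈ βs≈) (⊠-cong (⋆-identityʳ 𝟙) (shiftδ₀-⋆ (shift δ₀)))
  , ≈ₛ-trans (*s-sep δ₀ δ₀ (shift δ₀) δ₀ 1s≈ αs≈) (⊠-cong (⋆-identityˡ (shift δ₀)) (⋆-identityˡ δ₀))
  , ≈ₛ-trans (*s-sep δ₀ δ₀ δ₀ (shift δ₀) 1s≈ βs≈) (⊠-cong (⋆-identityˡ δ₀) (⋆-identityˡ (shift δ₀)))))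

tN-product : ℕ → Mat
tN-product n = mat (shift (negBinom (suc n)) ⊠ geometricFrom (suc n)) 0s (shift (negBinom n) ⊠ geometricFrom n) 0s

tN-product-base : prodT (tN 1) ≈M tN-product 0
tN-product-base = ≈M-trans (⊗-identityʳ (A₁∞ ⊗ A₀∞)) (≈M-trans (A₁∞⊗K≈ A₀∞)
  ( ≈ₛ-trans (*s-sep 𝟙 (shift δ₀) (shift δ₀) 𝟙 β/1-α≈ α/1-β≈) (⊠-cong (𝟙⋆shift-negBinom 0) (shiftδ₀-⋆ 𝟙))
  , *s-zeroʳ β/1-α
  , ≈ₛ-trans (*s-sep δ₀ δ₀ (shift δ₀) 𝟙 1s≈ α/1-β≈) (⊠-cong (⋆-identityˡ (shift δ₀)) (⋆-identityˡ 𝟙))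
  , *s-zeroʳ 1s))

tN-product-step : ∀ n → ((A₁∞ ⊗ (A₀ ⊗ I₂)) ⊗ tN-product n) ≈M tN-product (suc n)
tN-product-step n = ≈M-trans (⊗-cong A₁∞⊗A₀≈ (≈M-refl {tN-product n}))
  (≈M-trans (⊗-zeroColumn A₁∞A₀-sep (a ⊠ g) (b ⊠ h)) (top , (λ _ _ → refl) , bottom , (λ _ _ → refl)))
  where
  a = shift (negBinom (suc n))
  g = geometricFrom (suc n)
  b = shift (negBinom n)
  h = geometricFrom n
  top : (((shift 𝟙 ⊠ shift δ₀) *s (a ⊠ g)) +s ((𝟙 ⊠ shift (shift δ₀)) *s (b ⊠ h))) ≈ₛ m00 (tN-product (suc n))
  top = ≈ₛ-trans (+s-cong (*s-⊠ (shift 𝟙) (shift δ₀) a g) (*s-⊠ 𝟙 (shift (shift δ₀)) b h))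
    (≈ₛ-trans (+s-cong (⊠-cong shift𝟙⋆a (shiftδ₀-⋆ g)) (⊠-cong (𝟙⋆shift-negBinom n) shift²δ₀⋆h))
    (≈ₛ-trans (⊠-distribʳ-+s (shift (shift (negBinom (suc (suc n))))) (shift (negBinom (suc n))) (shift g))
              (⊠-cong (shift-negBinom-pascal (suc n)) (λ _ → refl))))
    where
    shift𝟙⋆a : (shift 𝟙 ⋆ a) ≗ shift (shift (negBinom (suc (suc n))))
    shift𝟙⋆a k = trans (⋆-shiftˡ 𝟙 a k) (shift-cong (𝟙⋆shift-negBinom (suc n)) k)
    shift²δ₀⋆h : (shift (shift δ₀) ⋆ h) ≗ shift g
    shift²δ₀⋆h k = trans (⋆-shiftˡ (shift δ₀) h k) (shift-cong (shiftδ₀-⋆ h) k)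
  bottom : (((shift δ₀ ⊠ δ₀) *s (a ⊠ g)) +s ((δ₀ ⊠ shift δ₀) *s (b ⊠ h))) ≈ₛ m10 (tN-product (suc n))
  bottom = ≈ₛ-trans (+s-cong (*s-⊠ (shift δ₀) δ₀ a g) (*s-⊠ δ₀ (shift δ₀) b h))
    (≈ₛ-trans (+s-cong (⊠-cong (shiftδ₀-⋆ a) (⋆-identityˡ g)) (⊠-cong (⋆-identityˡ b) (shiftδ₀-⋆ h)))
    (≈ₛ-trans (⊠-distribʳ-+s (shift a) b g) (⊠-cong (shift-negBinom-pascal n) (λ _ → refl))))

prodT-tN : ∀ n → prodT (tN (suc n)) ≈M tN-product n
prodT-tN zero    = tN-product-base
prodT-tN (suc n) = ≈M-trans (⊗-cong (≈M-refl {A₁∞ ⊗ (A₀ ⊗ I₂)}) (prodT-tN n)) (tN-product-step n)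

γ-tN : ∀ n → γ (tN (suc n)) ≈ₛ (shift (negBinom (suc n)) ⊠ geometricFrom (suc n))
γ-tN n = proj₁ (prodT-tN n)

-- Truncated negative binomial series

-- In Bernoulli trials with failure
-- probability z, (1 - z)ⁿ⁺¹ · partialNegBinom n z m is the probability of fewer than m failures before
-- success n + 1, and zᵐ · partialNegBinomᵀ n z m that of at most n successes before failure m; these
-- events are complementary (partialNegBinom-duality).

partialNegBinom : ℕ → ℚ → ℕ → ℚ
partialNegBinom n z m = Σ< m (λ k → negBinom (suc n) k * z ^ℚ k)

partialNegBinomᵀ : ℕ → ℚ → ℕ → ℚ
partialNegBinomᵀ n z m = Σ≤ n (λ s → (1ℚ - z) ^ℚ s * ℕ→ℚ (negBinomCoeff m s))

[1-z]*Σ< : ∀ v z m → (1ℚ - z) * Σ< m (λ k → v k * z ^ℚ k)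
                  ≡ Σ< m (λ k → (v k - shift v k) * z ^ℚ k) - shift v m * z ^ℚ m
[1-z]*Σ< v z zero    = *-zeroʳ (1ℚ - z)
[1-z]*Σ< v z (suc m) = begin
  (1ℚ - z) * (Σ< m (λ k → v k * z ^ℚ k) + v m * z ^ℚ m)
    ≡⟨ *-distribˡ-+ (1ℚ - z) _ (v m * z ^ℚ m) ⟩
  (1ℚ - z) * Σ< m (λ k → v k * z ^ℚ k) + (1ℚ - z) * (v m * z ^ℚ m)
    ≡⟨ cong (_+ (1ℚ - z) * (v m * z ^ℚ m)) ([1-z]*Σ< v z m) ⟩
  (Σ< m (λ k → (v k - shift v k) * z ^ℚ k) - shift v m * z ^ℚ m) + (1ℚ - z) * (v m * z ^ℚ m)
    ≡⟨ telescope (Σ< m (λ k → (v k - shift v k) * z ^ℚ k)) (shift v m) (v m) z (z ^ℚ m) ⟩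
  Σ< (suc m) (λ k → (v k - shift v k) * z ^ℚ k) - v m * (z * z ^ℚ m)
    ∎
  where
  open ≡-Reasoning
  telescope : ∀ σ s v z w → (σ - s * w) + (1ℚ - z) * (v * w) ≡ (σ + (v - s) * w) - v * (z * w)
  telescope = solve-∀ ℚ-ring

negBinom-difference : ∀ n k → negBinom (suc n) k - shift (negBinom (suc n)) k ≡ negBinom n k
negBinom-difference n k = begin
  negBinom (suc n) k - s                  ≡⟨ cong (_- s) (sym (negBinom-pascal n k)) ⟩
  (s + negBinom n k) - s                  ≡⟨ cancel s (negBinom n k) ⟩
  negBinom n k                            ∎
  where
  open ≡-Reasoning
  s = shift (negBinom (suc n)) k
  cancel : ∀ a b → (a + b) - a ≡ b
  cancel = solve-∀ ℚ-ring

shift-negBinom≡negBinomCoeff : ∀ n m → shift (negBinom (suc (suc n))) m ≡ ℕ→ℚ (negBinomCoeff m (suc n))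
shift-negBinom≡negBinomCoeff n zero    = cong ℕ→ℚ (sym (k>n⇒nCk≡0 (ℕ.n<1+n n)))
shift-negBinom≡negBinomCoeff n (suc m) = cong (λ x → ℕ→ℚ (x C suc n)) (ℕ.+-suc m n)

partialNegBinom-step : ∀ n z m →
  (1ℚ - z) * partialNegBinom (suc n) z m ≡ partialNegBinom n z m - ℕ→ℚ (negBinomCoeff m (suc n)) * z ^ℚ m
partialNegBinom-step n z m = begin
  (1ℚ - z) * partialNegBinom (suc n) z m
    ≡⟨ [1-z]*Σ< (negBinom (suc (suc n))) z m ⟩
  Σ< m (λ k → (negBinom (suc (suc n)) k - shift (negBinom (suc (suc n))) k) * z ^ℚ k) - shift (negBinom (suc (suc n))) m * z ^ℚ m
    ≡⟨ cong₂ (λ a b → a - b * z ^ℚ m) (Σ<-cong m (λ k → cong (_* z ^ℚ k) (negBinom-difference (suc n) k)))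
                                       (shift-negBinom≡negBinomCoeff n m) ⟩
  partialNegBinom n z m - ℕ→ℚ (negBinomCoeff m (suc n)) * z ^ℚ m
    ∎
  where open ≡-Reasoning

geometric-sum : ∀ z m → (1ℚ - z) * partialNegBinom 0 z m ≡ 1ℚ - z ^ℚ m
geometric-sum z zero    = trans (*-zeroʳ (1ℚ - z)) (sym (+-inverseʳ 1ℚ))
geometric-sum z (suc m) = begin
  (1ℚ - z) * (partialNegBinom 0 z m + 1ℚ * z ^ℚ m)           ≡⟨ *-distribˡ-+ (1ℚ - z) _ (1ℚ * z ^ℚ m) ⟩
  (1ℚ - z) * partialNegBinom 0 z m + (1ℚ - z) * (1ℚ * z ^ℚ m) ≡⟨ cong (_+ (1ℚ - z) * (1ℚ * z ^ℚ m)) (geometric-sum z m) ⟩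
  (1ℚ - z ^ℚ m) + (1ℚ - z) * (1ℚ * z ^ℚ m)                    ≡⟨ telescope z (z ^ℚ m) ⟩
  1ℚ - z * z ^ℚ m                                              ∎
  where
  open ≡-Reasoning
  telescope : ∀ z w → (1ℚ - w) + (1ℚ - z) * (1ℚ * w) ≡ 1ℚ - z * w
  telescope = solve-∀ ℚ-ring

partialNegBinom-duality : ∀ n z m → (1ℚ - z) ^ℚ suc n * partialNegBinom n z m + z ^ℚ m * partialNegBinomᵀ n z m ≡ 1ℚ
partialNegBinom-duality zero    z m = begin
  (1ℚ - z) * 1ℚ * partialNegBinom 0 z m + z ^ℚ m * (0ℚ + 1ℚ * 1ℚ) ≡⟨ simplify (1ℚ - z) (partialNegBinom 0 z m) (z ^ℚ m) ⟩
  (1ℚ - z) * partialNegBinom 0 z m + z ^ℚ m                        ≡⟨ cong (_+ z ^ℚ m) (geometric-sum z m) ⟩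
  1ℚ - z ^ℚ m + z ^ℚ m                                             ≡⟨ cancel (z ^ℚ m) ⟩
  1ℚ                                                               ∎
  where
  open ≡-Reasoning
  simplify : ∀ q s w → q * 1ℚ * s + w * (0ℚ + 1ℚ * 1ℚ) ≡ q * s + w
  simplify = solve-∀ ℚ-ring
  cancel : ∀ w → 1ℚ - w + w ≡ 1ℚ
  cancel = solve-∀ ℚ-ring
partialNegBinom-duality (suc n) z m = begin
  (1ℚ - z) * q * partialNegBinom (suc n) z m + w * (partialNegBinomᵀ n z m + q * c)
    ≡⟨ regroup (1ℚ - z) q (partialNegBinom (suc n) z m) w (partialNegBinomᵀ n z m) c ⟩
  q * ((1ℚ - z) * partialNegBinom (suc n) z m) + w * partialNegBinomᵀ n z m + w * q * c
    ≡⟨ cong (λ a → q * a + w * partialNegBinomᵀ n z m + w * q * c) (partialNegBinom-step n z m) ⟩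
  q * (partialNegBinom n z m - c * w) + w * partialNegBinomᵀ n z m + w * q * c
    ≡⟨ cancel q (partialNegBinom n z m) c w (partialNegBinomᵀ n z m) ⟩
  q * partialNegBinom n z m + w * partialNegBinomᵀ n z m
    ≡⟨ partialNegBinom-duality n z m ⟩
  1ℚ
    ∎
  where
  open ≡-Reasoning
  q = (1ℚ - z) ^ℚ suc n
  w = z ^ℚ m
  c = ℕ→ℚ (negBinomCoeff m (suc n))
  regroup : ∀ p q s w t c → p * q * s + w * (t + q * c) ≡ q * (p * s) + w * t + w * q * c
  regroup = solve-∀ ℚ-ring
  cancel : ∀ q s c w t → q * (s - c * w) + w * t + w * q * c ≡ q * s + w * t
  cancel = solve-∀ ℚ-ring

partialNegBinom-closed : ∀ n z m → (1ℚ - z) ^ℚ suc n * partialNegBinom n z m ≡ 1ℚ - z ^ℚ m * partialNegBinomᵀ n z m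
partialNegBinom-closed n z m = trans (a≡[a+b]-b _ (z ^ℚ m * partialNegBinomᵀ n z m))
                                     (cong (_- z ^ℚ m * partialNegBinomᵀ n z m) (partialNegBinom-duality n z m))

partialNegBinom-diagonal-step : ∀ n z → (1ℚ - z) * partialNegBinom (suc n) z (suc n)
  ≡ partialNegBinom n z n + z ^ℚ n * (ℕ→ℚ ((n ℕ.+ n) C n) - z * ℕ→ℚ (suc (n ℕ.+ n) C suc n))
partialNegBinom-diagonal-step n z = begin
  (1ℚ - z) * partialNegBinom (suc n) z (suc n)
    ≡⟨ partialNegBinom-step n z (suc n) ⟩
  (partialNegBinom n z n + c * z ^ℚ n) - d * (z * z ^ℚ n)
    ≡⟨ factor (partialNegBinom n z n) (z ^ℚ n) z c d ⟩
  partialNegBinom n z n + z ^ℚ n * (c - z * d)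
    ∎
  where
  open ≡-Reasoning
  c = ℕ→ℚ ((n ℕ.+ n) C n)
  d = ℕ→ℚ (suc (n ℕ.+ n) C suc n)
  factor : ∀ s w z c d → (s + c * w) - d * (z * w) ≡ s + w * (c - z * d)
  factor = solve-∀ ℚ-ring

central-doublingℚ : ∀ n → ℕ→ℚ ((suc n ℕ.+ suc n) C suc n) ≡ ℕ→ℚ 2 * ℕ→ℚ (suc (n ℕ.+ n) C suc n)
central-doublingℚ n = trans (cong ℕ→ℚ (central-doubling n)) (ℕ→ℚ-* 2 (suc (n ℕ.+ n) C suc n))

½-diagonal : ∀ n → ½ ^ℚ suc n * partialNegBinom n ½ n ≡ ½ - ℕ→ℚ ((n ℕ.+ n) C n) * ½ * ¼ ^ℚ n
½-diagonal zero    = refl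
½-diagonal (suc n) = begin
  ½ * h * partialNegBinom (suc n) ½ (suc n)       ≡⟨ halve h (partialNegBinom (suc n) ½ (suc n)) ⟩
  h * ((1ℚ - ½) * partialNegBinom (suc n) ½ (suc n)) ≡⟨ cong (h *_) (partialNegBinom-diagonal-step n ½) ⟩
  h * (partialNegBinom n ½ n + p * (c - ½ * d))    ≡⟨ expand (partialNegBinom n ½ n) p c d ⟩
  h * partialNegBinom n ½ n + ½ * (p * p) * (c - ½ * d)
    ≡⟨ cong₂ (λ a b → a + ½ * b * (c - ½ * d)) (½-diagonal n) (sym (^ℚ-distrib-* ½ ½ n)) ⟩
  (½ - c * ½ * f) + ½ * f * (c - ½ * d)            ≡⟨ collect c d f ⟩
  ½ - (ℕ→ℚ 2 * d) * ½ * (¼ * f)                    ≡⟨ cong (λ x → ½ - x * ½ * (¼ * f)) (sym (central-doublingℚ n)) ⟩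
  ½ - ℕ→ℚ ((suc n ℕ.+ suc n) C suc n) * ½ * (¼ * f) ∎
  where
  open ≡-Reasoning
  p = ½ ^ℚ n
  h = ½ ^ℚ suc n
  f = ¼ ^ℚ n
  c = ℕ→ℚ ((n ℕ.+ n) C n)
  d = ℕ→ℚ (suc (n ℕ.+ n) C suc n)
  halve : ∀ a s → ½ * a * s ≡ a * ((1ℚ - ½) * s)
  halve = solve-∀ ℚ-ring
  expand : ∀ s p c d → (½ * p) * (s + p * (c - ½ * d)) ≡ (½ * p) * s + ½ * (p * p) * (c - ½ * d)
  expand = solve-∀ ℚ-ring
  collect : ∀ c d f → (½ - c * ½ * f) + ½ * f * (c - ½ * d) ≡ ½ - (ℕ→ℚ 2 * d) * ½ * (¼ * f)
  collect = solve-∀ ℚ-ring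

1/12^*3^≡¼^ : ∀ n → 1/12 ^ℚ n * ℕ→ℚ (3 ℕ.^ n) ≡ ¼ ^ℚ n
1/12^*3^≡¼^ n = trans (cong (1/12 ^ℚ n *_) (ℕ→ℚ-^ 3 n)) (sym (^ℚ-distrib-* 1/12 (ℕ→ℚ 3) n))

oddRowSum₃-recℚ : ∀ n → ℕ→ℚ (oddRowSum₃ (suc n))
  ≡ ℕ→ℚ 16 * ℕ→ℚ (oddRowSum₃ n) - ℕ→ℚ 6 * (ℕ→ℚ (3 ℕ.^ n) * ℕ→ℚ (suc (n ℕ.+ n) C suc n))
oddRowSum₃-recℚ n = begin
  ℕ→ℚ q′                                        ≡⟨ a≡[a+b]-b (ℕ→ℚ q′) (ℕ→ℚ (6 ℕ.* (t ℕ.* d))) ⟩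
  (ℕ→ℚ q′ + ℕ→ℚ (6 ℕ.* (t ℕ.* d))) - ℕ→ℚ (6 ℕ.* (t ℕ.* d))
    ≡⟨ cong₂ _-_ (trans (sym (ℕ→ℚ-+ q′ _)) (cong ℕ→ℚ (oddRowSum₃-rec n))) (cast-6td) ⟩
  ℕ→ℚ (16 ℕ.* oddRowSum₃ n) - ℕ→ℚ 6 * (ℕ→ℚ t * ℕ→ℚ d)
    ≡⟨ cong (_- ℕ→ℚ 6 * (ℕ→ℚ t * ℕ→ℚ d)) (ℕ→ℚ-* 16 (oddRowSum₃ n)) ⟩
  ℕ→ℚ 16 * ℕ→ℚ (oddRowSum₃ n) - ℕ→ℚ 6 * (ℕ→ℚ t * ℕ→ℚ d)
    ∎
  where
  open ≡-Reasoning
  q′ = oddRowSum₃ (suc n)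
  t = 3 ℕ.^ n
  d = suc (n ℕ.+ n) C suc n
  cast-6td : ℕ→ℚ (6 ℕ.* (t ℕ.* d)) ≡ ℕ→ℚ 6 * (ℕ→ℚ t * ℕ→ℚ d)
  cast-6td = trans (ℕ→ℚ-* 6 (t ℕ.* d)) (cong (ℕ→ℚ 6 *_) (ℕ→ℚ-* t d))

¼-diagonal : ∀ n → partialNegBinom n ¼ n ≡ 4/3 ^ℚ suc n - ℕ→ℚ ((n ℕ.+ n) C n) * ¼ ^ℚ n - ⅓ * 1/12 ^ℚ n * ℕ→ℚ (oddRowSum₃ n)
¼-diagonal zero    = refl
¼-diagonal (suc n) = begin
  partialNegBinom (suc n) ¼ (suc n)
    ≡⟨ unquarter (partialNegBinom (suc n) ¼ (suc n)) ⟩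
  4/3 * ((1ℚ - ¼) * partialNegBinom (suc n) ¼ (suc n))
    ≡⟨ cong (4/3 *_) (partialNegBinom-diagonal-step n ¼) ⟩
  4/3 * (partialNegBinom n ¼ n + ¼ ^ℚ n * (c - ¼ * d))
    ≡⟨ cong (λ x → 4/3 * (x + ¼ ^ℚ n * (c - ¼ * d))) (¼-diagonal n) ⟩
  4/3 * ((k - c * ¼ ^ℚ n - ⅓ * w * q) + ¼ ^ℚ n * (c - ¼ * d))
    ≡⟨ cong (λ f → 4/3 * ((k - c * f - ⅓ * w * q) + f * (c - ¼ * d))) (sym (1/12^*3^≡¼^ n)) ⟩
  4/3 * ((k - c * (w * t) - ⅓ * w * q) + (w * t) * (c - ¼ * d))
    ≡⟨ collect k c d w t q ⟩
  4/3 * k - (ℕ→ℚ 2 * d) * (¼ * (w * t)) - ⅓ * (1/12 * w) * (ℕ→ℚ 16 * q - ℕ→ℚ 6 * (t * d))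
    ≡⟨ cong₂ (λ a f → 4/3 * k - a * (¼ * f) - ⅓ * (1/12 * w) * (ℕ→ℚ 16 * q - ℕ→ℚ 6 * (t * d)))
             (sym (central-doublingℚ n)) (1/12^*3^≡¼^ n) ⟩
  4/3 * k - ℕ→ℚ ((suc n ℕ.+ suc n) C suc n) * (¼ * ¼ ^ℚ n) - ⅓ * (1/12 * w) * (ℕ→ℚ 16 * q - ℕ→ℚ 6 * (t * d))
    ≡⟨ cong (λ b → 4/3 * k - ℕ→ℚ ((suc n ℕ.+ suc n) C suc n) * (¼ * ¼ ^ℚ n) - ⅓ * (1/12 * w) * b)
            (sym (oddRowSum₃-recℚ n)) ⟩
  4/3 * k - ℕ→ℚ ((suc n ℕ.+ suc n) C suc n) * (¼ * ¼ ^ℚ n) - ⅓ * (1/12 * w) * ℕ→ℚ (oddRowSum₃ (suc n))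
    ∎
  where
  open ≡-Reasoning
  k = 4/3 ^ℚ suc n
  w = 1/12 ^ℚ n
  t = ℕ→ℚ (3 ℕ.^ n)
  q = ℕ→ℚ (oddRowSum₃ n)
  c = ℕ→ℚ ((n ℕ.+ n) C n)
  d = ℕ→ℚ (suc (n ℕ.+ n) C suc n)
  unquarter : ∀ s → s ≡ 4/3 * ((1ℚ - ¼) * s)
  unquarter = solve-∀ ℚ-ring
  collect : ∀ k c d w t q → 4/3 * ((k - c * (w * t) - ⅓ * w * q) + (w * t) * (c - ¼ * d))
                            ≡ 4/3 * k - (ℕ→ℚ 2 * d) * (¼ * (w * t)) - ⅓ * (1/12 * w) * (ℕ→ℚ 16 * q - ℕ→ℚ 6 * (t * d))
  collect = solve-∀ ℚ-ring

-- Partial sums of c_t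

geometricFrom-below : ∀ p j → j ℕ.< p → geometricFrom p j ≡ 0ℚ
geometricFrom-below (suc p) zero    _         = refl
geometricFrom-below (suc p) (suc j) (s≤s j<p) = geometricFrom-below p j j<p

geometricFrom-above : ∀ p t → geometricFrom p (p ℕ.+ t) ≡ 1ℚ
geometricFrom-above zero    t = refl
geometricFrom-above (suc p) t = geometricFrom-above p t

Σ<-½^*geometricFrom : ∀ p r → Σ< (suc p ℕ.+ r) (λ j → ½ ^ℚ j * geometricFrom (suc p) j) ≡ ½ ^ℚ p - ½ ^ℚ (p ℕ.+ r)
Σ<-½^*geometricFrom p zero    = begin
  Σ< (suc p ℕ.+ 0) (λ j → ½ ^ℚ j * geometricFrom (suc p) j) ≡⟨ Σ<-zero (suc p ℕ.+ 0) vanish ⟩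
  0ℚ                                                        ≡⟨ sym (+-inverseʳ (½ ^ℚ p)) ⟩
  ½ ^ℚ p - ½ ^ℚ p                                           ≡⟨ cong (λ x → ½ ^ℚ p - ½ ^ℚ x) (sym (ℕ.+-identityʳ p)) ⟩
  ½ ^ℚ p - ½ ^ℚ (p ℕ.+ 0)                                   ∎
  where
  open ≡-Reasoning
  vanish : ∀ j → j ℕ.< suc p ℕ.+ 0 → ½ ^ℚ j * geometricFrom (suc p) j ≡ 0ℚ
  vanish j j<p = trans (cong (½ ^ℚ j *_) (geometricFrom-below (suc p) j (subst (j ℕ.<_) (ℕ.+-identityʳ (suc p)) j<p)))
                       (*-zeroʳ (½ ^ℚ j))
Σ<-½^*geometricFrom p (suc r) = begin
  Σ< (suc p ℕ.+ suc r) f                           ≡⟨ cong (λ x → Σ< x f) (ℕ.+-suc (suc p) r) ⟩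
  Σ< (suc p ℕ.+ r) f + ½ ^ℚ (suc p ℕ.+ r) * geometricFrom (suc p) (suc p ℕ.+ r)
    ≡⟨ cong₂ (λ a b → a + ½ ^ℚ (suc p ℕ.+ r) * b) (Σ<-½^*geometricFrom p r) (geometricFrom-above (suc p) r) ⟩
  (½ ^ℚ p - ½ ^ℚ (p ℕ.+ r)) + ½ * ½ ^ℚ (p ℕ.+ r) * 1ℚ ≡⟨ halve (½ ^ℚ p) (½ ^ℚ (p ℕ.+ r)) ⟩
  ½ ^ℚ p - ½ ^ℚ suc (p ℕ.+ r)                       ≡⟨ cong (λ x → ½ ^ℚ p - ½ ^ℚ x) (sym (ℕ.+-suc p r)) ⟩
  ½ ^ℚ p - ½ ^ℚ (p ℕ.+ suc r)                       ∎
  where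
  open ≡-Reasoning
  f = λ j → ½ ^ℚ j * geometricFrom (suc p) j
  halve : ∀ x y → (x - y) + ½ * y * 1ℚ ≡ x - ½ * y
  halve = solve-∀ ℚ-ring

cRow : List (ℕ̄₊ × ℕ̄₊) → ℕ → ℚ
cRow t i = Σ≤ i (λ j → (½ ^ℚ (i ℕ.+ j)) * γ t i j)

cRow-tN : ∀ n i → cRow (tN (suc n)) i
  ≡ (shift (negBinom (suc n)) i * ½ ^ℚ i) * Σ≤ i (λ j → ½ ^ℚ j * geometricFrom (suc n) j)
cRow-tN n i = trans (Σ<-cong (suc i) term) (sym (Σ<-*ˡ (suc i) (a * ½ ^ℚ i) _))
  where
  a = shift (negBinom (suc n)) i
  regroup : ∀ p q a g → (p * q) * (a * g) ≡ (a * p) * (q * g)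
  regroup = solve-∀ ℚ-ring
  term : ∀ j → ½ ^ℚ (i ℕ.+ j) * γ (tN (suc n)) i j ≡ (a * ½ ^ℚ i) * (½ ^ℚ j * geometricFrom (suc n) j)
  term j = trans (cong₂ _*_ (^ℚ-+ ½ i j) (γ-tN n i j)) (regroup (½ ^ℚ i) (½ ^ℚ j) a _)

cRow-low : ∀ n i → i ℕ.≤ n → cRow (tN (suc n)) i ≡ 0ℚ
cRow-low n i i≤n = trans (cRow-tN n i) (trans (cong (a *_) (Σ<-zero (suc i) vanish)) (*-zeroʳ a))
  where
  a = shift (negBinom (suc n)) i * ½ ^ℚ i
  vanish : ∀ j → j ℕ.< suc i → ½ ^ℚ j * geometricFrom (suc n) j ≡ 0ℚ
  vanish j j≤i = trans (cong (½ ^ℚ j *_) (geometricFrom-below (suc n) j (ℕ.≤-trans j≤i (s≤s i≤n)))) (*-zeroʳ (½ ^ℚ j))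

cRow-high : ∀ n t → cRow (tN (suc n)) (suc (n ℕ.+ t))
  ≡ ½ ^ℚ suc n * (negBinom (suc n) (n ℕ.+ t) * ½ ^ℚ (n ℕ.+ t)) - ¼ * (negBinom (suc n) (n ℕ.+ t) * ¼ ^ℚ (n ℕ.+ t))
cRow-high n t = begin
  cRow (tN (suc n)) (suc (n ℕ.+ t))
    ≡⟨ cRow-tN n (suc (n ℕ.+ t)) ⟩
  (c * (½ * x)) * Σ< (suc (suc (n ℕ.+ t))) (λ j → ½ ^ℚ j * geometricFrom (suc n) j)
    ≡⟨ cong (λ m → (c * (½ * x)) * Σ< (suc m) (λ j → ½ ^ℚ j * geometricFrom (suc n) j)) (sym (ℕ.+-suc n t)) ⟩
  (c * (½ * x)) * Σ< (suc n ℕ.+ suc t) (λ j → ½ ^ℚ j * geometricFrom (suc n) j)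
    ≡⟨ cong ((c * (½ * x)) *_) (Σ<-½^*geometricFrom n (suc t)) ⟩
  (c * (½ * x)) * (½ ^ℚ n - ½ ^ℚ (n ℕ.+ suc t))
    ≡⟨ cong (λ m → (c * (½ * x)) * (½ ^ℚ n - ½ ^ℚ m)) (ℕ.+-suc n t) ⟩
  (c * (½ * x)) * (½ ^ℚ n - ½ * x)
    ≡⟨ expand c x (½ ^ℚ n) ⟩
  (½ * ½ ^ℚ n) * (c * x) - ¼ * (c * (x * x))
    ≡⟨ cong (λ y → (½ * ½ ^ℚ n) * (c * x) - ¼ * (c * y)) (sym (^ℚ-distrib-* ½ ½ (n ℕ.+ t))) ⟩
  ½ ^ℚ suc n * (c * x) - ¼ * (c * ¼ ^ℚ (n ℕ.+ t))
    ∎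
  where
  open ≡-Reasoning
  c = negBinom (suc n) (n ℕ.+ t)
  x = ½ ^ℚ (n ℕ.+ t)
  expand : ∀ c x y → (c * (½ * x)) * (y - ½ * x) ≡ (½ * y) * (c * x) - ¼ * (c * (x * x))
  expand = solve-∀ ℚ-ring

cPartial-tN : ∀ n r → cPartial (tN (suc n)) (suc n ℕ.+ r)
  ≡ ½ ^ℚ suc n * (partialNegBinom n ½ (n ℕ.+ r) - partialNegBinom n ½ n)
    - ¼ * (partialNegBinom n ¼ (n ℕ.+ r) - partialNegBinom n ¼ n)
cPartial-tN n r = begin
  Σ< (suc n ℕ.+ r) (cRow (tN (suc n)))
    ≡⟨ Σ<-split (suc n) r (cRow (tN (suc n))) ⟩
  Σ< (suc n) (cRow (tN (suc n))) + Σ< r (λ t → cRow (tN (suc n)) (suc n ℕ.+ t))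
    ≡⟨ cong₂ _+_ (Σ<-zero (suc n) (λ i i<1+n → cRow-low n i (ℕ.≤-pred i<1+n))) (Σ<-cong r (cRow-high n)) ⟩
  0ℚ + Σ< r (λ t → h * term ½ t - ¼ * term ¼ t)
    ≡⟨ trans (+-identityˡ _) (Σ<-- r (λ t → h * term ½ t) (λ t → ¼ * term ¼ t)) ⟩
  Σ< r (λ t → h * term ½ t) - Σ< r (λ t → ¼ * term ¼ t)
    ≡⟨ cong₂ _-_ (sym (Σ<-*ˡ r h (term ½))) (sym (Σ<-*ˡ r ¼ (term ¼))) ⟩
  h * Σ< r (term ½) - ¼ * Σ< r (term ¼)
    ≡⟨ cong₂ (λ a b → h * a - ¼ * b) (Σ<-from n r (λ k → negBinom (suc n) k * ½ ^ℚ k))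
                                      (Σ<-from n r (λ k → negBinom (suc n) k * ¼ ^ℚ k)) ⟩
  h * (partialNegBinom n ½ (n ℕ.+ r) - partialNegBinom n ½ n) - ¼ * (partialNegBinom n ¼ (n ℕ.+ r) - partialNegBinom n ¼ n)
    ∎
  where
  open ≡-Reasoning
  h = ½ ^ℚ suc n
  term : ℚ → ℕ → ℚ
  term z t = negBinom (suc n) (n ℕ.+ t) * z ^ℚ (n ℕ.+ t)

closedForm-suc : ∀ n → closedForm (suc n) ≡ ½ + ℕ→ℚ ((n ℕ.+ n) C n) * ¼ ^ℚ suc n - 1/12 ^ℚ suc n * ℕ→ℚ (oddRowSum₃ n)
closedForm-suc n = begin
  closedForm (suc n)
    ≡⟨ cong₂ (λ a b → ½ + ℕ→ℚ (a C n) * ¼ ^ℚ suc n - 1/12 ^ℚ suc n * Σ< (suc n) (λ j → ℕ→ℚ ((b C j) ℕ.* 3 ℕ.^ j)))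
             (cong (ℕ._∸ 2) (2[1+n]≡2+[n+n] n)) (cong (ℕ._∸ 1) (2[1+n]≡2+[n+n] n)) ⟩
  ½ + ℕ→ℚ ((n ℕ.+ n) C n) * ¼ ^ℚ suc n - 1/12 ^ℚ suc n * Σ< (suc n) (λ j → ℕ→ℚ ((suc (n ℕ.+ n) C j) ℕ.* 3 ℕ.^ j))
    ≡⟨ cong (λ x → ½ + ℕ→ℚ ((n ℕ.+ n) C n) * ¼ ^ℚ suc n - 1/12 ^ℚ suc n * x) (sym (ℕ→ℚ-Σℕ< (suc n) _)) ⟩
  ½ + ℕ→ℚ ((n ℕ.+ n) C n) * ¼ ^ℚ suc n - 1/12 ^ℚ suc n * ℕ→ℚ (oddRowSum₃ n)
    ∎
  where
  open ≡-Reasoning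
  2[1+n]≡2+[n+n] : ∀ n → 2 ℕ.* suc n ≡ 2 ℕ.+ (n ℕ.+ n)
  2[1+n]≡2+[n+n] = ℕ-Solver.solve-∀

tailError : ℕ → ℕ → ℚ
tailError n m = ½ ^ℚ m * partialNegBinomᵀ n ½ m - ¼ * 4/3 ^ℚ suc n * (¼ ^ℚ m * partialNegBinomᵀ n ¼ m)

cPartial-tN≡closedForm-tailError : ∀ n r → cPartial (tN (suc n)) (suc n ℕ.+ r) ≡ closedForm (suc n) - tailError n (n ℕ.+ r)
cPartial-tN≡closedForm-tailError n r = begin
  cPartial (tN (suc n)) (suc n ℕ.+ r)
    ≡⟨ cPartial-tN n r ⟩
  h * (A - Aₙ) - ¼ * (B - Bₙ)
    ≡⟨ cong (λ x → h * (A - Aₙ) - ¼ * (x - Bₙ)) (sym (trans (cong (_* B) (^ℚ-inverse (suc n) refl)) (*-identityˡ B))) ⟩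
  h * (A - Aₙ) - ¼ * (k * e * B - Bₙ)
    ≡⟨ expand h A Aₙ k e B Bₙ ⟩
  h * A - h * Aₙ - ¼ * k * (e * B) + ¼ * Bₙ
    ≡⟨ cong₂ (λ x y → x - y - ¼ * k * (e * B) + ¼ * Bₙ) (partialNegBinom-closed n ½ m) (½-diagonal n) ⟩
  (1ℚ - a) - (½ - c * ½ * f) - ¼ * k * (e * B) + ¼ * Bₙ
    ≡⟨ cong₂ (λ x y → (1ℚ - a) - (½ - c * ½ * f) - ¼ * k * x + ¼ * y) (partialNegBinom-closed n ¼ m) (¼-diagonal n) ⟩
  (1ℚ - a) - (½ - c * ½ * f) - ¼ * k * (1ℚ - b) + ¼ * (k - c * f - ⅓ * w * q)
    ≡⟨ collect a b c f k w q ⟩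
  (½ + c * (¼ * f) - (1/12 * w) * q) - (a - ¼ * k * b)
    ≡⟨ cong (_- tailError n m) (sym (closedForm-suc n)) ⟩
  closedForm (suc n) - tailError n m
    ∎
  where
  open ≡-Reasoning
  m = n ℕ.+ r
  h = ½ ^ℚ suc n
  k = 4/3 ^ℚ suc n
  e = ¾ ^ℚ suc n
  f = ¼ ^ℚ n
  w = 1/12 ^ℚ n
  c = ℕ→ℚ ((n ℕ.+ n) C n)
  q = ℕ→ℚ (oddRowSum₃ n)
  A = partialNegBinom n ½ m
  Aₙ = partialNegBinom n ½ n
  B = partialNegBinom n ¼ m
  Bₙ = partialNegBinom n ¼ n
  a = ½ ^ℚ m * partialNegBinomᵀ n ½ m
  b = ¼ ^ℚ m * partialNegBinomᵀ n ¼ m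
  expand : ∀ h A Aₙ k e B Bₙ → h * (A - Aₙ) - ¼ * (k * e * B - Bₙ) ≡ h * A - h * Aₙ - ¼ * k * (e * B) + ¼ * Bₙ
  expand = solve-∀ ℚ-ring
  collect : ∀ a b c f k w q → (1ℚ - a) - (½ - c * ½ * f) - ¼ * k * (1ℚ - b) + ¼ * (k - c * f - ⅓ * w * q)
                              ≡ (½ + c * (¼ * f) - (1/12 * w) * q) - (a - ¼ * k * b)
  collect = solve-∀ ℚ-ring

-- Convergence

partialNegBinomᵀ-nonNeg : ∀ n z m → 0ℚ ≤ 1ℚ - z → 0ℚ ≤ partialNegBinomᵀ n z m
partialNegBinomᵀ-nonNeg n z m 0≤1-z =
  Σ<-nonNeg (suc n) (λ s → *-nonNeg (^ℚ-nonNeg s 0≤1-z) (ℕ→ℚ-nonNeg (negBinomCoeff m s)))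

partialNegBinomᵀ-≤ : ∀ n z m → 0ℚ ≤ 1ℚ - z → 1ℚ - z ≤ 1ℚ → partialNegBinomᵀ n z m ≤ ℕ→ℚ ((m ℕ.+ n) C n)
partialNegBinomᵀ-≤ n z m 0≤1-z 1-z≤1 = begin
  partialNegBinomᵀ n z m                   ≤⟨ Σ<-mono-≤ (suc n) drop-weight ⟩
  Σ≤ n (λ s → ℕ→ℚ (negBinomCoeff m s))     ≡⟨ sym (ℕ→ℚ-Σℕ< (suc n) (negBinomCoeff m)) ⟩
  ℕ→ℚ (Σℕ< (suc n) (negBinomCoeff m))      ≡⟨ cong ℕ→ℚ (Σ-negBinomCoeff m n) ⟩
  ℕ→ℚ ((m ℕ.+ n) C n)                      ∎
  where
  open ≤-Reasoning
  drop-weight : ∀ s → (1ℚ - z) ^ℚ s * ℕ→ℚ (negBinomCoeff m s) ≤ ℕ→ℚ (negBinomCoeff m s)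
  drop-weight s = subst ((1ℚ - z) ^ℚ s * ℕ→ℚ (negBinomCoeff m s) ≤_) (*-identityˡ (ℕ→ℚ (negBinomCoeff m s)))
    (*-monoʳ-≤-nonNeg (ℕ→ℚ (negBinomCoeff m s)) {{nonNegative (ℕ→ℚ-nonNeg (negBinomCoeff m s))}} (^ℚ-≤1 s 0≤1-z 1-z≤1))

¼^≤½^ : ∀ r → ¼ ^ℚ r ≤ ½ ^ℚ r
¼^≤½^ r = begin
  ¼ ^ℚ r                ≡⟨ ^ℚ-distrib-* ½ ½ r ⟩
  ½ ^ℚ r * ½ ^ℚ r       ≤⟨ *-monoˡ-≤-nonNeg (½ ^ℚ r) {{nonNegative (^ℚ-nonNeg r 0≤½)}} (^ℚ-≤1 r 0≤½ ½≤1) ⟩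
  ½ ^ℚ r * 1ℚ           ≡⟨ *-identityʳ (½ ^ℚ r) ⟩
  ½ ^ℚ r                ∎
  where open ≤-Reasoning

tailError-coefficient-≤ : ∀ n r → ¼ * 4/3 ^ℚ suc n * ¼ ^ℚ (n ℕ.+ r) ≤ ½ ^ℚ r
tailError-coefficient-≤ n r = begin
  ¼ * 4/3 ^ℚ suc n * ¼ ^ℚ (n ℕ.+ r)          ≡⟨ cong (¼ * 4/3 ^ℚ suc n *_) (^ℚ-+ ¼ n r) ⟩
  ¼ * 4/3 ^ℚ suc n * (¼ ^ℚ n * ¼ ^ℚ r)       ≡⟨ regroup (4/3 ^ℚ suc n) (¼ ^ℚ n) (¼ ^ℚ r) ⟩
  4/3 ^ℚ suc n * ¼ ^ℚ suc n * ¼ ^ℚ r         ≡⟨ cong (_* ¼ ^ℚ r) (sym (^ℚ-distrib-* 4/3 ¼ (suc n))) ⟩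
  ⅓ ^ℚ suc n * ¼ ^ℚ r                        ≤⟨ *-mono-≤-nonNeg (^ℚ-nonNeg (suc n) 0≤⅓) (^ℚ-nonNeg r 0≤¼)
                                                   (^ℚ-≤1 (suc n) 0≤⅓ ⅓≤1) (¼^≤½^ r) ⟩
  1ℚ * ½ ^ℚ r                                ≡⟨ *-identityˡ (½ ^ℚ r) ⟩
  ½ ^ℚ r                                     ∎
  where
  open ≤-Reasoning
  0≤⅓ = toWitness {a? = 0ℚ ≤? ⅓} _
  ⅓≤1 = toWitness {a? = ⅓ ≤? 1ℚ} _
  regroup : ∀ k f g → ¼ * k * (f * g) ≡ k * (¼ * f) * g
  regroup = solve-∀ ℚ-ring

tailError-≤ : ∀ n r → ∣ tailError n (n ℕ.+ r) ∣ ≤ ½ ^ℚ r * (ℕ→ℚ 2 * ℕ→ℚ ((n ℕ.+ r ℕ.+ n) C n))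
tailError-≤ n r = begin
  ∣ a - b ∣                     ≤⟨ ∣p-q∣≤∣p∣+∣q∣ a b ⟩
  ∣ a ∣ + ∣ b ∣                 ≡⟨ cong₂ _+_ (0≤p⇒∣p∣≡p 0≤a) (0≤p⇒∣p∣≡p 0≤b) ⟩
  a + b                         ≤⟨ +-mono-≤ a≤ b≤ ⟩
  ½ ^ℚ r * c + ½ ^ℚ r * c       ≡⟨ double (½ ^ℚ r) c ⟩
  ½ ^ℚ r * (ℕ→ℚ 2 * c)          ∎
  where
  open ≤-Reasoning
  m = n ℕ.+ r
  c = ℕ→ℚ ((m ℕ.+ n) C n)
  κ = ¼ * 4/3 ^ℚ suc n * ¼ ^ℚ m
  a = ½ ^ℚ m * partialNegBinomᵀ n ½ m
  b = ¼ * 4/3 ^ℚ suc n * (¼ ^ℚ m * partialNegBinomᵀ n ¼ m)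
  0≤κ : 0ℚ ≤ κ
  0≤κ = *-nonNeg (*-nonNeg 0≤¼ (^ℚ-nonNeg (suc n) (toWitness {a? = 0ℚ ≤? 4/3} _))) (^ℚ-nonNeg m 0≤¼)
  b≡ : b ≡ κ * partialNegBinomᵀ n ¼ m
  b≡ = sym (*-assoc (¼ * 4/3 ^ℚ suc n) (¼ ^ℚ m) _)
  0≤a : 0ℚ ≤ a
  0≤a = *-nonNeg (^ℚ-nonNeg m 0≤½) (partialNegBinomᵀ-nonNeg n ½ m 0≤½)
  0≤b : 0ℚ ≤ b
  0≤b = subst (0ℚ ≤_) (sym b≡) (*-nonNeg 0≤κ (partialNegBinomᵀ-nonNeg n ¼ m 0≤¾))
  a≤ : a ≤ ½ ^ℚ r * c
  a≤ = *-mono-≤-nonNeg (^ℚ-nonNeg m 0≤½) (partialNegBinomᵀ-nonNeg n ½ m 0≤½)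
         (^ℚ-antitone n r 0≤½ ½≤1) (partialNegBinomᵀ-≤ n ½ m 0≤½ ½≤1)
  b≤ : b ≤ ½ ^ℚ r * c
  b≤ = subst (_≤ ½ ^ℚ r * c) (sym b≡) (*-mono-≤-nonNeg 0≤κ (partialNegBinomᵀ-nonNeg n ¼ m 0≤¾)
         (tailError-coefficient-≤ n r) (partialNegBinomᵀ-≤ n ¼ m 0≤¾ ¾≤1))
  double : ∀ h c → h * c + h * c ≡ h * (ℕ→ℚ 2 * c)
  double = solve-∀ ℚ-ring

binomial-decay : ∀ n M t → n ℕ.+ n ℕ.+ n ℕ.≤ M → ℕ→ℚ ((t ℕ.+ M) C n) * ½ ^ℚ t ≤ ℕ→ℚ (M C n) * ¾ ^ℚ t
binomial-decay n M t 3n≤M = begin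
  ℕ→ℚ c₁ * ½ ^ℚ t                         ≡⟨ cong (ℕ→ℚ c₁ *_) (^ℚ-scaled 2 ¼ t) ⟩
  ℕ→ℚ c₁ * (ℕ→ℚ (2 ℕ.^ t) * ¼ ^ℚ t)       ≡⟨ regroup (ℕ→ℚ c₁) (ℕ→ℚ (2 ℕ.^ t)) (¼ ^ℚ t) ⟩
  (ℕ→ℚ (2 ℕ.^ t) * ℕ→ℚ c₁) * ¼ ^ℚ t       ≡⟨ cong (_* ¼ ^ℚ t) (sym (ℕ→ℚ-* (2 ℕ.^ t) c₁)) ⟩
  ℕ→ℚ (2 ℕ.^ t ℕ.* c₁) * ¼ ^ℚ t           ≤⟨ *-monoʳ-≤-nonNeg (¼ ^ℚ t) {{nonNegative (^ℚ-nonNeg t 0≤¼)}}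
                                                (ℕ→ℚ-mono-≤ (2^t[t+MCn]≤3^t[MCn] n M t 3n≤M)) ⟩
  ℕ→ℚ (3 ℕ.^ t ℕ.* c₀) * ¼ ^ℚ t           ≡⟨ cong (_* ¼ ^ℚ t) (ℕ→ℚ-* (3 ℕ.^ t) c₀) ⟩
  (ℕ→ℚ (3 ℕ.^ t) * ℕ→ℚ c₀) * ¼ ^ℚ t       ≡⟨ sym (regroup (ℕ→ℚ c₀) (ℕ→ℚ (3 ℕ.^ t)) (¼ ^ℚ t)) ⟩
  ℕ→ℚ c₀ * (ℕ→ℚ (3 ℕ.^ t) * ¼ ^ℚ t)       ≡⟨ cong (ℕ→ℚ c₀ *_) (sym (^ℚ-scaled 3 ¼ t)) ⟩
  ℕ→ℚ c₀ * ¾ ^ℚ t                         ∎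
  where
  open ≤-Reasoning
  c₁ = (t ℕ.+ M) C n
  c₀ = M C n
  regroup : ∀ c p f → c * (p * f) ≡ (p * c) * f
  regroup = solve-∀ ℚ-ring

tailError-geometric : ∀ n t → ∣ tailError n (n ℕ.+ (n ℕ.+ t)) ∣ ≤ ℕ→ℚ (2 ℕ.* ((n ℕ.+ n ℕ.+ n) C n)) * ¾ ^ℚ t
tailError-geometric n t = begin
  ∣ tailError n (n ℕ.+ (n ℕ.+ t)) ∣              ≤⟨ tailError-≤ n (n ℕ.+ t) ⟩
  ½ ^ℚ (n ℕ.+ t) * (two * ℕ→ℚ ((n ℕ.+ (n ℕ.+ t) ℕ.+ n) C n))
    ≡⟨ cong (λ x → ½ ^ℚ (n ℕ.+ t) * (two * ℕ→ℚ (x C n))) (reindex n t) ⟩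
  ½ ^ℚ (n ℕ.+ t) * (two * c)                      ≤⟨ *-monoʳ-≤-nonNeg (two * c) {{nonNegative 0≤2c}} (^ℚ-antitone n t 0≤½ ½≤1) ⟩
  ½ ^ℚ t * (two * c)                              ≡⟨ regroup (½ ^ℚ t) two c ⟩
  two * (c * ½ ^ℚ t)                              ≤⟨ *-monoˡ-≤-nonNeg two {{nonNegative (ℕ→ℚ-nonNeg 2)}}
                                                       (binomial-decay n (n ℕ.+ n ℕ.+ n) t ℕ.≤-refl) ⟩
  two * (ℕ→ℚ ((n ℕ.+ n ℕ.+ n) C n) * ¾ ^ℚ t)      ≡⟨ sym (*-assoc two (ℕ→ℚ ((n ℕ.+ n ℕ.+ n) C n)) (¾ ^ℚ t)) ⟩
  two * ℕ→ℚ ((n ℕ.+ n ℕ.+ n) C n) * ¾ ^ℚ t        ≡⟨ cong (_* ¾ ^ℚ t) (sym (ℕ→ℚ-* 2 ((n ℕ.+ n ℕ.+ n) C n))) ⟩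
  ℕ→ℚ (2 ℕ.* ((n ℕ.+ n ℕ.+ n) C n)) * ¾ ^ℚ t      ∎
  where
  open ≤-Reasoning
  two = ℕ→ℚ 2
  c = ℕ→ℚ ((t ℕ.+ (n ℕ.+ n ℕ.+ n)) C n)
  0≤2c = *-nonNeg (ℕ→ℚ-nonNeg 2) (ℕ→ℚ-nonNeg ((t ℕ.+ (n ℕ.+ n ℕ.+ n)) C n))
  reindex : ∀ n t → n ℕ.+ (n ℕ.+ t) ℕ.+ n ≡ t ℕ.+ (n ℕ.+ n ℕ.+ n)
  reindex = ℕ-Solver.solve-∀
  regroup : ∀ h a c → h * (a * c) ≡ a * (c * h)
  regroup = solve-∀ ℚ-ring

archimedean : ∀ ε → 0ℚ < ε → ∃ λ d → 1ℚ ≤ ε * ℕ→ℚ (suc d)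
archimedean (mkℚ (+ zero)  d _) (*<* (+<+ ()))
archimedean (mkℚ (+ suc p) d c) _ = d , subst (_≤ ε * ℕ→ℚ (suc d)) (trans (*-comm 1/[d+1] (ℕ→ℚ (suc d))) [d+1]*1/[d+1]≡1)
  (*-monoʳ-≤-nonNeg (ℕ→ℚ (suc d)) {{nonNegative (ℕ→ℚ-nonNeg (suc d))}} 1/[d+1]≤ε)
  where
  ε = mkℚ (+ suc p) d c
  1/[d+1] = mkℚ (+ 1) d (1-coprimeTo (suc d))
  1/[d+1]≤ε : 1/[d+1] ≤ ε
  1/[d+1]≤ε = *≤* (+≤+ (ℕ.*-monoˡ-≤ (suc d) (s≤s (z≤n {p}))))
  [d+1]*1/[d+1]≡1 : ℕ→ℚ (suc d) * 1/[d+1] ≡ 1ℚ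
  [d+1]*1/[d+1]≡1 = trans (cong (_* 1/[d+1]) (ℕ→ℚ≡mkℚ (suc d)))
                          (*-inverseʳ (mkℚ (+ suc d) 0 (coprime-sym (1-coprimeTo (suc d)))))

¾^-vanishes : ∀ K ε → 0ℚ < ε → ∃ λ T → ℕ→ℚ K * ¾ ^ℚ T < ε
¾^-vanishes K ε 0<ε with archimedean ε 0<ε
... | d , 1≤ε[d+1] = T , *-cancelʳ-<-nonNeg (ℕ→ℚ (suc d)) {{nonNegative (ℕ→ℚ-nonNeg (suc d))}} (<-≤-trans bound 1≤ε[d+1])
  where
  X = K ℕ.* suc d
  T = 3 ℕ.* X
  regroup : ∀ k t f e → k * (t * f) * e ≡ (t * (k * e)) * f
  regroup = solve-∀ ℚ-ring
  bound : ℕ→ℚ K * ¾ ^ℚ T * ℕ→ℚ (suc d) < 1ℚ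
  bound = begin-strict
    ℕ→ℚ K * ¾ ^ℚ T * ℕ→ℚ (suc d)                         ≡⟨ cong (λ x → ℕ→ℚ K * x * ℕ→ℚ (suc d)) (^ℚ-scaled 3 ¼ T) ⟩
    ℕ→ℚ K * (ℕ→ℚ (3 ℕ.^ T) * ¼ ^ℚ T) * ℕ→ℚ (suc d)       ≡⟨ regroup (ℕ→ℚ K) (ℕ→ℚ (3 ℕ.^ T)) (¼ ^ℚ T) (ℕ→ℚ (suc d)) ⟩
    (ℕ→ℚ (3 ℕ.^ T) * (ℕ→ℚ K * ℕ→ℚ (suc d))) * ¼ ^ℚ T     ≡⟨ cong (λ x → (ℕ→ℚ (3 ℕ.^ T) * x) * ¼ ^ℚ T) (sym (ℕ→ℚ-* K (suc d))) ⟩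
    (ℕ→ℚ (3 ℕ.^ T) * ℕ→ℚ X) * ¼ ^ℚ T                     ≡⟨ cong (_* ¼ ^ℚ T) (sym (ℕ→ℚ-* (3 ℕ.^ T) X)) ⟩
    ℕ→ℚ (3 ℕ.^ T ℕ.* X) * ¼ ^ℚ T                         <⟨ *-monoˡ-<-pos (¼ ^ℚ T) {{positive (^ℚ-pos T (toWitness {a? = 0ℚ <? ¼} _))}}
                                                              (ℕ→ℚ-mono-< (3^[3X]*X<4^[3X] X)) ⟩
    ℕ→ℚ (4 ℕ.^ T) * ¼ ^ℚ T                               ≡⟨ cong (_* ¼ ^ℚ T) (ℕ→ℚ-^ 4 T) ⟩
    ℕ→ℚ 4 ^ℚ T * ¼ ^ℚ T                                  ≡⟨ ^ℚ-inverse T refl ⟩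
    1ℚ                                                   ∎
    where open ≤-Reasoning

CEquals-geometric : ∀ t v (E : ℕ → ℚ) M₀ K → (∀ s → cPartial t (M₀ ℕ.+ s) ≡ v - E s) →
  (∀ s → ∣ E s ∣ ≤ ℕ→ℚ K * ¾ ^ℚ s) → CEquals t v
CEquals-geometric t v E M₀ K cPartial≡ ∣E∣≤ ε 0<ε = M₀ ℕ.+ T , close
  where
  T = proj₁ (¾^-vanishes K ε 0<ε)
  cancel : ∀ v e → (v - e) - v ≡ - e
  cancel = solve-∀ ℚ-ring
  close-from : ∀ k → ∣ cPartial t (M₀ ℕ.+ (k ℕ.+ T)) - v ∣ < ε
  close-from k = begin-strict
    ∣ cPartial t (M₀ ℕ.+ (k ℕ.+ T)) - v ∣     ≡⟨ cong (λ x → ∣ x - v ∣) (cPartial≡ (k ℕ.+ T)) ⟩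
    ∣ (v - E (k ℕ.+ T)) - v ∣                  ≡⟨ trans (cong ∣_∣ (cancel v (E (k ℕ.+ T)))) (∣-p∣≡∣p∣ (E (k ℕ.+ T))) ⟩
    ∣ E (k ℕ.+ T) ∣                            ≤⟨ ∣E∣≤ (k ℕ.+ T) ⟩
    ℕ→ℚ K * ¾ ^ℚ (k ℕ.+ T)                    ≤⟨ *-monoˡ-≤-nonNeg (ℕ→ℚ K) {{nonNegative (ℕ→ℚ-nonNeg K)}} (^ℚ-antitone k T 0≤¾ ¾≤1) ⟩
    ℕ→ℚ K * ¾ ^ℚ T                            <⟨ proj₂ (¾^-vanishes K ε 0<ε) ⟩
    ε                                          ∎
    where open ≤-Reasoning
  close : ∀ m → M₀ ℕ.+ T ℕ.≤ m → ∣ cPartial t m - v ∣ < ε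
  close m M≤m = subst (λ x → ∣ cPartial t x - v ∣ < ε) M₀+[k+T]≡m (close-from k)
    where
    k = proj₁ (ℕ.m≤n⇒∃[o]m+o≡n M≤m)
    M₀+[k+T]≡m : M₀ ℕ.+ (k ℕ.+ T) ≡ m
    M₀+[k+T]≡m = trans (cong (M₀ ℕ.+_) (ℕ.+-comm k T))
                       (trans (sym (ℕ.+-assoc M₀ T k)) (proj₂ (ℕ.m≤n⇒∃[o]m+o≡n M≤m)))

tN-converges : ∀ n → CEquals (tN (suc n)) (closedForm (suc n))
tN-converges n = CEquals-geometric (tN (suc n)) (closedForm (suc n)) (λ t → tailError n (n ℕ.+ (n ℕ.+ t)))
  (suc n ℕ.+ n) (2 ℕ.* ((n ℕ.+ n ℕ.+ n) C n))
  (λ t → trans (cong (cPartial (tN (suc n))) (ℕ.+-assoc (suc n) n t)) (cPartial-tN≡closedForm-tailError n (n ℕ.+ t)))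
  (tailError-geometric n)

-- The lower bound

closedForm-excess : ∀ n → closedForm (suc n) - ½ ≡ ℕ→ℚ (centralExcess n) * 1/12 ^ℚ suc n
closedForm-excess n = begin
  closedForm (suc n) - ½                          ≡⟨ cong (_- ½) (closedForm-suc n) ⟩
  (½ + c * ¼ ^ℚ suc n - w * q) - ½                ≡⟨ cong (λ x → (½ + c * x - w * q) - ½) (sym (1/12^*3^≡¼^ (suc n))) ⟩
  (½ + c * (w * t) - w * q) - ½                   ≡⟨ regroup c t w q ⟩
  (t * c) * w - q * w                             ≡⟨ cong (λ x → x * w - q * w) (sym (ℕ→ℚ-* (3 ℕ.^ suc n) ((n ℕ.+ n) C n))) ⟩
  ℕ→ℚ (centralTerm₃ n) * w - q * w                ≡⟨ cong (λ x → ℕ→ℚ x * w - q * w) (sym (ℕ.m∸n+n≡m (oddRowSum₃≤centralTerm₃ n))) ⟩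
  ℕ→ℚ (centralExcess n ℕ.+ oddRowSum₃ n) * w - q * w ≡⟨ cong (λ x → x * w - q * w) (ℕ→ℚ-+ (centralExcess n) (oddRowSum₃ n)) ⟩
  (ℕ→ℚ (centralExcess n) + q) * w - q * w         ≡⟨ cancel (ℕ→ℚ (centralExcess n)) q w ⟩
  ℕ→ℚ (centralExcess n) * w                       ∎
  where
  open ≡-Reasoning
  c = ℕ→ℚ ((n ℕ.+ n) C n)
  q = ℕ→ℚ (oddRowSum₃ n)
  t = ℕ→ℚ (3 ℕ.^ suc n)
  w = 1/12 ^ℚ suc n
  regroup : ∀ c t w q → (½ + c * (w * t) - w * q) - ½ ≡ (t * c) * w - q * w
  regroup = solve-∀ ℚ-ring
  cancel : ∀ d q w → (d + q) * w - q * w ≡ d * w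
  cancel = solve-∀ ℚ-ring

πLower2≡304/105 : πLower 2 ≡ + 304 / 105
πLower2≡304/105 = refl

1/12^-pos : ∀ n → 0ℚ < 1/12 ^ℚ n
1/12^-pos n = ^ℚ-pos n (toWitness {a? = 0ℚ <? 1/12} _)

closedForm-excess-pos : ∀ n → 0ℚ < closedForm (suc n) - ½
closedForm-excess-pos n = subst (0ℚ <_) (sym (closedForm-excess n))
  (positive⁻¹ (ℕ→ℚ (centralExcess n) * w)
    {{pos*pos⇒pos (ℕ→ℚ (centralExcess n)) {{positive (ℕ→ℚ-mono-< (centralExcess-pos n))}} w {{positive (1/12^-pos (suc n))}}}})
  where w = 1/12 ^ℚ suc n

closedForm-excess-large : ∀ n → let d = closedForm (suc n) - ½ in 1ℚ < ℕ→ℚ (16 ℕ.* suc n ℕ.^ 3) * (d * d) * πLower 2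
closedForm-excess-large n = begin-strict
  1ℚ                                               ≡⟨ sym one≡ ⟩
  ℕ→ℚ (105 ℕ.* 144 ℕ.^ suc n) * r                  <⟨ *-monoˡ-<-pos r {{positive 0<r}} (ℕ→ℚ-mono-< (excess-inequality n)) ⟩
  ℕ→ℚ (304 ℕ.* (X ℕ.* (δ ℕ.* δ))) * r              ≡⟨ cong (_* r) cast ⟩
  (ℕ→ℚ 304 * (ℕ→ℚ X * (ℕ→ℚ δ * ℕ→ℚ δ))) * r       ≡⟨ regroup (ℕ→ℚ X) (ℕ→ℚ δ) w ⟩
  ℕ→ℚ X * ((ℕ→ℚ δ * w) * (ℕ→ℚ δ * w)) * (+ 304 / 105)
    ≡⟨ cong₂ (λ x y → ℕ→ℚ X * (x * x) * y) (sym (closedForm-excess n)) (sym πLower2≡304/105) ⟩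
  ℕ→ℚ X * (d * d) * πLower 2                       ∎
  where
  open ≤-Reasoning
  δ = centralExcess n
  w = 1/12 ^ℚ suc n
  d = closedForm (suc n) - ½
  X = 16 ℕ.* suc n ℕ.^ 3
  r = (w * w) * (+ 1 / 105)
  0<r : 0ℚ < r
  0<r = positive⁻¹ r {{pos*pos⇒pos (w * w) {{pos*pos⇒pos w {{positive (1/12^-pos (suc n))}} w {{positive (1/12^-pos (suc n))}}}} (+ 1 / 105)}}
  one≡ : ℕ→ℚ (105 ℕ.* 144 ℕ.^ suc n) * r ≡ 1ℚ
  one≡ = trans (cong (_* r) (ℕ→ℚ-* 105 (144 ℕ.^ suc n))) (trans (cancel105 (ℕ→ℚ (144 ℕ.^ suc n)) (w * w))
           (trans (cong₂ _*_ (ℕ→ℚ-^ 144 (suc n)) (sym (^ℚ-distrib-* 1/12 1/12 (suc n)))) (^ℚ-inverse (suc n) refl)))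
    where
    cancel105 : ∀ a b → (ℕ→ℚ 105 * a) * (b * (+ 1 / 105)) ≡ a * b
    cancel105 = solve-∀ ℚ-ring
  cast : ℕ→ℚ (304 ℕ.* (X ℕ.* (δ ℕ.* δ))) ≡ ℕ→ℚ 304 * (ℕ→ℚ X * (ℕ→ℚ δ * ℕ→ℚ δ))
  cast = trans (ℕ→ℚ-* 304 (X ℕ.* (δ ℕ.* δ))) (cong (ℕ→ℚ 304 *_) (trans (ℕ→ℚ-* X (δ ℕ.* δ)) (cong (ℕ→ℚ X *_) (ℕ→ℚ-* δ δ))))
  regroup : ∀ x δ w → (ℕ→ℚ 304 * (x * (δ * δ))) * ((w * w) * (+ 1 / 105)) ≡ x * ((δ * w) * (δ * w)) * (+ 304 / 105)
  regroup = solve-∀ ℚ-ring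

tN-aboveBound : ∀ n → AboveBound (suc n) (closedForm (suc n))
tN-aboveBound n = closedForm-excess-pos n , 2 , closedForm-excess-large n

proposition6p4 : ∀ (N : ℕ) → 1 ℕ.≤ N →
    CEquals (tN N) (closedForm N) × AboveBound N (closedForm N)
proposition6p4 zero    ()
proposition6p4 (suc n) _ = tN-converges n , tN-aboveBound n
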